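{- Let $a\in\mathbb Q_3$ with $|a-1|_3\le1/3$, and define $\phi=\phi_{a,3}:\mathbb Q_3^2\to\mathbb Q_3^2$ by $\phi(x,y)=(a+3y-x^2,x)$. Then $J(\phi)$ is an attracting $2$-cycle.
   Context: $|\cdot|_3$ is the $3$-adic absolute value with $|3|_3=1/3$, and $\|(x,y)\|=\max(|x|_3,|y|_3)$. $J(\phi)$ is the set of $(x,y)\in\mathbb Q_3^2$ whose two-sided orbit $\{\phi^n(x,y):n\in\mathbb Z\}$ is bounded. For a homeomorphism $\phi$ of a metric space $(M,d)$, an attractor is a nonempty compact set $\mathcal A$ with $\phi(\mathcal A)=\mathcal A$ for which some open set $U$ properly containing $\mathcal A$ satisfies $\lim_{n\to+\infty}\min_{\alpha\in\mathcal A}d(\phi^n(\beta),\alpha)=0$ for all $\beta\in U$. An attracting $2$-cycle is an attractor of the form $\{P,\phi(P)\}$ with $\phi^2(P)=P\ne\phi(P)$. -}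

module Defs where

open import Data.Nat as ℕ using (ℕ; zero; suc)
open import Data.Integer using (ℤ; +_; -[1+_]; _+_; _*_; -_; _-_; 0ℤ; 1ℤ)
open import Data.Integer.Divisibility.Signed
  using (_∣_; ∣-refl; ∣m∣n⇒∣m+n; ∣n⇒∣m*n; ∣m⇒∣-m; ∣m⇒∣m*n)
open import Data.Integer.Tactic.RingSolver using (solve-∀)
open import Data.Product using (Σ; ∃; _×_; _,_; proj₁; proj₂)
open import Data.Sum using (_⊎_)
open import Data.Unit using (⊤)
open import Relation.Nullary using (¬_)
open import Relation.Binary.PropositionalEquality using (_≡_; subst; sym)

-- 3-adic integers: coherent sequences of integers.
-- res n is a representative of x modulo 3^n, and res (n+1) ≡ res n (mod 3^n).

pow3 : ℕ → ℤ
pow3 n = + (3 ℕ.^ n)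

record ℤ₃ : Set where
  constructor mkℤ₃
  field
    res : ℕ → ℤ
    coh : ∀ n → pow3 n ∣ res (suc n) - res n
open ℤ₃ public

private
  lemAdd : ∀ a b c d → (a + b) - (c + d) ≡ (a - c) + (b - d)
  lemAdd = solve-∀
  lemNeg : ∀ a c → (- a) - (- c) ≡ - (a - c)
  lemNeg = solve-∀
  lemMul : ∀ a b c d → a * b - c * d ≡ a * (b - d) + (a - c) * d
  lemMul = solve-∀
  lemConst : ∀ z p → z - z ≡ p * 0ℤ
  lemConst = solve-∀

_≈ℤ₃_ : ℤ₃ → ℤ₃ → Set
x ≈ℤ₃ y = ∀ n → pow3 n ∣ res x n - res y n

constℤ₃ : ℤ → ℤ₃
constℤ₃ z = mkℤ₃ (λ _ → z)
  (λ n → subst (pow3 n ∣_) (sym (lemConst z (pow3 n))) (∣m⇒∣m*n 0ℤ ∣-refl))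

_+ℤ₃_ : ℤ₃ → ℤ₃ → ℤ₃
x +ℤ₃ y = mkℤ₃ (λ n → res x n + res y n)
  (λ n → subst (pow3 n ∣_)
    (sym (lemAdd (res x (suc n)) (res y (suc n)) (res x n) (res y n)))
    (∣m∣n⇒∣m+n (coh x n) (coh y n)))

-ℤ₃_ : ℤ₃ → ℤ₃
-ℤ₃ x = mkℤ₃ (λ n → - res x n)
  (λ n → subst (pow3 n ∣_) (sym (lemNeg (res x (suc n)) (res x n)))
    (∣m⇒∣-m (coh x n)))

_*ℤ₃_ : ℤ₃ → ℤ₃ → ℤ₃
x *ℤ₃ y = mkℤ₃ (λ n → res x n * res y n)
  (λ n → subst (pow3 n ∣_)
    (sym (lemMul (res x (suc n)) (res y (suc n)) (res x n) (res y n)))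
    (∣m∣n⇒∣m+n (∣n⇒∣m*n (res x (suc n)) (coh y n))
               (∣m⇒∣m*n (res y n) (coh x n))))

-- 3-adic numbers ℚ₃: a pair (x , k) represents x / 3^k with x ∈ ℤ₃.

record ℚ₃ : Set where
  constructor _/3^_
  field
    num : ℤ₃
    den : ℕ
open ℚ₃ public

_≈_ : ℚ₃ → ℚ₃ → Set
p ≈ q = (num p *ℤ₃ constℤ₃ (pow3 (den q))) ≈ℤ₃ (num q *ℤ₃ constℤ₃ (pow3 (den p)))

fromℤ : ℤ → ℚ₃
fromℤ z = constℤ₃ z /3^ 0

_+ₚ_ : ℚ₃ → ℚ₃ → ℚ₃
p +ₚ q = ((num p *ℤ₃ constℤ₃ (pow3 (den q))) +ℤ₃ (num q *ℤ₃ constℤ₃ (pow3 (den p))))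
         /3^ (den p ℕ.+ den q)

-ₚ_ : ℚ₃ → ℚ₃
-ₚ p = (-ℤ₃ num p) /3^ den p

_-ₚ_ : ℚ₃ → ℚ₃ → ℚ₃
p -ₚ q = p +ₚ (-ₚ q)

_*ₚ_ : ℚ₃ → ℚ₃ → ℚ₃
p *ₚ q = (num p *ℤ₃ num q) /3^ (den p ℕ.+ den q)

div3 : ℚ₃ → ℚ₃
div3 p = num p /3^ suc (den p)

-- The 3-adic absolute value.  Its values lie in {0} ∪ 3^ℤ, so it is
-- completely described by the relations  |q|₃ ≤ 3^m  (m ∈ ℤ).

-- |x|₃ ≤ 3^(-n) for x ∈ ℤ₃, i.e. x ≡ 0 mod 3^n
divBy3^ : ℕ → ℤ₃ → Set
divBy3^ n x = pow3 n ∣ res x n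

-- normLe q m  means  |q|₃ ≤ 3^m.   For q = x/3^k: |q|₃ ≤ 3^m ⇔ |x|₃ ≤ 3^(m-k).
normLe : ℚ₃ → ℤ → Set
normLe q m with (+ den q) - m
... | + n     = divBy3^ n (num q)
... | -[1+ _ ] = ⊤

-- The plane ℚ₃² with the max norm ‖(x,y)‖ = max(|x|₃,|y|₃)

ℚ₃² : Set
ℚ₃² = ℚ₃ × ℚ₃

_≈²_ : ℚ₃² → ℚ₃² → Set
(x , y) ≈² (x' , y') = (x ≈ x') × (y ≈ y')

norm²Le : ℚ₃² → ℤ → Set
norm²Le (x , y) m = normLe x m × normLe y m

distLe : ℚ₃² → ℚ₃² → ℤ → Set
distLe (x , y) (x' , y') m = normLe (x -ₚ x') m × normLe (y -ₚ y') m

φ : ℚ₃ → ℚ₃² → ℚ₃²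
φ a (x , y) = ((a +ₚ (fromℤ (+ 3) *ₚ y)) -ₚ (x *ₚ x)) , x

φ⁻¹ : ℚ₃ → ℚ₃² → ℚ₃²
φ⁻¹ a (u , v) = v , div3 ((u -ₚ a) +ₚ (v *ₚ v))

iter : {A : Set} → (A → A) → ℕ → A → A
iter f zero    x = x
iter f (suc n) x = f (iter f n x)

φ^ : ℚ₃ → ℤ → ℚ₃² → ℚ₃²
φ^ a (+ n)     β = iter (φ a) n β
φ^ a -[1+ n ]  β = iter (φ⁻¹ a) (suc n) β

J : ℚ₃ → ℚ₃² → Set
J a β = ∃ λ (m : ℤ) → ∀ (n : ℤ) → norm²Le (φ^ a n β) m

InCycle : ℚ₃ → ℚ₃² → ℚ₃² → Set
InCycle a P β = (β ≈² P) ⊎ (β ≈² φ a P)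

-- U ⊆ ℚ₃² is open (balls {γ : d(β,γ) ≤ 3^m} are the open balls
-- of radius 3^(m+1) in this ultrametric)
IsOpen : (ℚ₃² → Set) → Set
IsOpen U = ∀ β → U β → ∃ λ (m : ℤ) → ∀ γ → distLe β γ m → U γ

-- {P, φ(P)} is an attracting 2-cycle of φ = φ_{a,3}.
-- (A two-point set is nonempty and compact; φ({P,φP}) = {P,φP} follows from φ²P = P.)
AttractingTwoCycle : ℚ₃ → ℚ₃² → Set₁
AttractingTwoCycle a P =
  (φ a (φ a P) ≈² P)
  × ¬ (φ a P ≈² P)
  × Σ (ℚ₃² → Set) λ U →
      IsOpen U
      × (∀ β → InCycle a P β → U β)
      × (∃ λ β → U β × ¬ InCycle a P β)
      × (∀ β → U β → ∀ (m : ℤ) → ∃ λ (N : ℕ) → ∀ n → N ℕ.≤ n →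
           distLe (iter (φ a) n β) P m ⊎ distLe (iter (φ a) n β) (φ a P) m)

JIsAttractingTwoCycle : ℚ₃ → Set₁
JIsAttractingTwoCycle a =
  Σ ℚ₃² λ P → AttractingTwoCycle a P
            × (∀ β → J a β → InCycle a P β)
            × (∀ β → InCycle a P β → J a β)

{-# OPTIONS --safe #-}
module Submission where

open import Defs
open import Data.Empty using (⊥; ⊥-elim)
open import Data.Integer using (ℤ; +_; -[1+_]; _+_; _*_; -_; _-_; 0ℤ; -1ℤ; NonZero; ∣_∣)
open import Data.Integer.DivMod using (_%ℕ_; _/ℕ_; n%ℕd<d; a≡a%ℕn+[a/ℕn]*n)
open import Data.Integer.Divisibility.Signed
import Data.Integer.Properties as ℤₚ
open import Data.Integer.Tactic.RingSolver using (solve-∀)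
open import Data.Nat as ℕ using (ℕ; zero; suc)
import Data.Nat.Divisibility as ℕᵈ
open import Data.Nat.Primality using (euclidsLemma; prime?)
import Data.Nat.Properties as ℕₚ
import Data.Nat.Tactic.RingSolver as ℕ-Solver
open import Data.Product using (Σ; ∃; _×_; _,_; proj₁; proj₂)
open import Data.Sum using (_⊎_; inj₁; inj₂; [_,_]′)
open import Data.Unit using (tt)
open import Relation.Binary.PropositionalEquality using (_≡_; refl; sym; trans; cong; subst; subst₂; module ≡-Reasoning)
open import Relation.Nullary using (¬_)
open import Relation.Nullary.Decidable using (from-yes)

-- Orbits of φ are sequences with y₂ = a + 3y₀ − y₁².  Hensel's lemma gives r = √(a − 3) with
-- r ≡ 1 (mod 3), and p, q = −1 ± r form the 2-cycle P = (p , q), with p ≡ 0 and q ≡ 1 (mod 3).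
-- Compare an orbit with the cycle digit by digit: the term 3y₀ costs no precision, and
-- y₁² − c₁² = (y₁ − c₁)(y₁ + c₁) gains a digit whenever c₁ = p.  Hence an orbit agreeing with
-- the cycle modulo 3 agrees with it modulo 3^(h+1) after 3h steps, which makes the set U of
-- points congruent to P or φ(P) modulo 3 a basin of attraction.  Conversely, along a bounded
-- backward orbit x₁² = 3x₂ − x₀ + a lowers the exponent of the bound, so the orbit is eventually
-- integral; modulo 3 it then obeys xⱼ ≡ 1 − xⱼ₊₁², forcing the residues 0 and 1 to alternate,
-- and running the digit-gaining argument forward from ever earlier times pins the starting point
-- to the cycle.

-- Congruences and powers of 3 in ℤ

infix 4 _≡_[mod_]
record _≡_[mod_] (x y m : ℤ) : Set where
  constructor mod
  field ∣-diff : m ∣ x - y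
open _≡_[mod_] public

module _ {m : ℤ} where

  mod-reflexive : ∀ {x y} → x ≡ y → x ≡ y [mod m ]
  mod-reflexive {x} refl = mod (divides 0ℤ (trans (ℤₚ.+-inverseʳ x) (sym (ℤₚ.*-zeroˡ m))))

  mod-refl : ∀ {x} → x ≡ x [mod m ]
  mod-refl = mod-reflexive refl

  mod-sym : ∀ {x y} → x ≡ y [mod m ] → y ≡ x [mod m ]
  mod-sym {x} {y} (mod d) = mod (subst (m ∣_) (lemma x y) (∣m⇒∣-m d))
    where
    lemma : ∀ x y → - (x - y) ≡ y - x
    lemma = solve-∀

  mod-trans : ∀ {x y z} → x ≡ y [mod m ] → y ≡ z [mod m ] → x ≡ z [mod m ]
  mod-trans {x} {y} {z} (mod d) (mod e) = mod (subst (m ∣_) (lemma x y z) (∣m∣n⇒∣m+n d e))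
    where
    lemma : ∀ x y z → (x - y) + (y - z) ≡ x - z
    lemma = solve-∀

  mod-+ : ∀ {x y u v} → x ≡ y [mod m ] → u ≡ v [mod m ] → x + u ≡ y + v [mod m ]
  mod-+ {x} {y} {u} {v} (mod d) (mod e) = mod (subst (m ∣_) (lemma x y u v) (∣m∣n⇒∣m+n d e))
    where
    lemma : ∀ x y u v → (x - y) + (u - v) ≡ (x + u) - (y + v)
    lemma = solve-∀

  mod-neg : ∀ {x y} → x ≡ y [mod m ] → - x ≡ - y [mod m ]
  mod-neg {x} {y} (mod d) = mod (subst (m ∣_) (lemma x y) (∣m⇒∣-m d))
    where
    lemma : ∀ x y → - (x - y) ≡ (- x) - (- y)
    lemma = solve-∀

  mod-* : ∀ {x y u v} → x ≡ y [mod m ] → u ≡ v [mod m ] → x * u ≡ y * v [mod m ]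
  mod-* {x} {y} {u} {v} (mod d) (mod e) =
    mod (subst (m ∣_) (lemma x y u v) (∣m∣n⇒∣m+n (∣n⇒∣m*n x e) (∣m⇒∣m*n v d)))
    where
    lemma : ∀ x y u v → x * (u - v) + (x - y) * v ≡ x * u - y * v
    lemma = solve-∀

mod-modulus : ∀ {m m′ x y} → m ≡ m′ → x ≡ y [mod m ] → x ≡ y [mod m′ ]
mod-modulus refl x≡y = x≡y

mod-1 : ∀ {x y} → x ≡ y [mod + 1 ]
mod-1 {x} {y} = mod (divides (x - y) (sym (ℤₚ.*-identityʳ (x - y))))

mod-weaken : ∀ {n m x y} → n ∣ m → x ≡ y [mod m ] → x ≡ y [mod n ]
mod-weaken n∣m (mod d) = mod (∣-trans n∣m d)

mod-scale : ∀ {m x y} c → x ≡ y [mod m ] → x * c ≡ y * c [mod m * c ]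
mod-scale {m} {x} {y} c (mod d) = mod (subst (m * c ∣_) (lemma x y c) (*-monoˡ-∣ c d))
  where
  lemma : ∀ x y c → (x - y) * c ≡ x * c - y * c
  lemma = solve-∀

mod-cancel : ∀ c {m x y} .{{_ : NonZero c}} → x * c ≡ y * c [mod m * c ] → x ≡ y [mod m ]
mod-cancel c {m} {x} {y} (mod d) = mod (*-cancelʳ-∣ c (subst (m * c ∣_) (lemma x y c) d))
  where
  lemma : ∀ x y c → x * c - y * c ≡ (x - y) * c
  lemma = solve-∀

mod-∣ : ∀ {m x y} → x ≡ y [mod m ] → m ∣ y → m ∣ x
mod-∣ {m} {x} {y} (mod d) e = subst (m ∣_) (lemma x y) (∣m∣n⇒∣m+n d e)
  where
  lemma : ∀ x y → (x - y) + y ≡ x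
  lemma = solve-∀

∣-* : ∀ {a b x y} → a ∣ x → b ∣ y → a * b ∣ x * y
∣-* {a} {b} (divides α refl) (divides β refl) = divides (α * β) (lemma α a β b)
  where
  lemma : ∀ α a β b → (α * a) * (β * b) ≡ (α * β) * (a * b)
  lemma = solve-∀

difference-of-squares : ∀ {m n v w} → v ≡ w [mod m ] → v + w ≡ 0ℤ [mod n ] →
                        v * v ≡ w * w [mod m * n ]
difference-of-squares {m} {n} {v} {w} (mod d) (mod e) =
  mod (subst (m * n ∣_) (lemma v w) (∣-* d e))
  where
  lemma : ∀ v w → (v - w) * ((v + w) - 0ℤ) ≡ v * v - w * w
  lemma = solve-∀

square-mod-3 : ∀ v → v * v ≡ 0ℤ [mod + 3 ] ⊎ v * v ≡ + 1 [mod + 3 ]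
square-mod-3 v =
  cases (v %ℕ 3) (n%ℕd<d v 3) (mod (divides (v /ℕ 3) (lemma {+ (v %ℕ 3)} {v /ℕ 3} (a≡a%ℕn+[a/ℕn]*n v 3))))
  where
  lemma : ∀ {r q} → v ≡ r + q * + 3 → v - r ≡ q * + 3
  lemma {r} {q} refl = ring r q
    where
    ring : ∀ r q → (r + q * + 3) - r ≡ q * + 3
    ring = solve-∀
  cases : ∀ r → r ℕ.< 3 → v ≡ + r [mod + 3 ] → v * v ≡ 0ℤ [mod + 3 ] ⊎ v * v ≡ + 1 [mod + 3 ]
  cases 0 _ v≡r = inj₁ (mod-* v≡r v≡r)
  cases 1 _ v≡r = inj₂ (mod-* v≡r v≡r)
  cases 2 _ v≡r = inj₂ (mod-trans (mod-* v≡r v≡r) (mod (divides (+ 1) refl)))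
  cases (suc (suc (suc r))) (ℕ.s≤s (ℕ.s≤s (ℕ.s≤s ())))

+3≢-mod-9 : ∀ z → ¬ (z + + 3 ≡ z [mod + 9 ])
+3≢-mod-9 z (mod 9∣3) =
  ℕᵈ.>⇒∤ (ℕ.s≤s (ℕ.s≤s (ℕ.s≤s (ℕ.s≤s (ℕ.z≤n {5}))))) (∣⇒∣ᵤ (subst (+ 9 ∣_) (lemma z) 9∣3))
  where
  lemma : ∀ z → (z + + 3) - z ≡ + 3
  lemma = solve-∀

pow3-+ : ∀ a b → pow3 (a ℕ.+ b) ≡ pow3 a * pow3 b
pow3-+ a b = trans (cong +_ (ℕₚ.^-distribˡ-+-* 3 a b)) (ℤₚ.pos-* (3 ℕ.^ a) (3 ℕ.^ b))

pow3-split : ∀ a b {c} → a ℕ.+ b ≡ c → pow3 c ≡ pow3 a * pow3 b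
pow3-split a b refl = pow3-+ a b

pow3-suc : ∀ a → pow3 (suc a) ≡ + 3 * pow3 a
pow3-suc a = ℤₚ.pos-* 3 (3 ℕ.^ a)

pow3-∣ : ∀ {a b} → a ℕ.≤ b → pow3 a ∣ pow3 b
pow3-∣ {a} {b} a≤b = divides (pow3 (b ℕ.∸ a))
  (trans (pow3-split a (b ℕ.∸ a) (ℕₚ.m+[n∸m]≡n a≤b)) (ℤₚ.*-comm (pow3 a) (pow3 (b ℕ.∸ a))))

mod-3* : ∀ {k x y} → x ≡ y [mod pow3 k ] → + 3 * x ≡ + 3 * y [mod pow3 (suc k) ]
mod-3* {k} {x} {y} x≡y =
  mod-modulus (trans (ℤₚ.*-comm (pow3 k) (+ 3)) (sym (pow3-suc k)))
    (mod-trans (mod-reflexive (ℤₚ.*-comm (+ 3) x))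
      (mod-trans (mod-scale (+ 3) x≡y) (mod-reflexive (ℤₚ.*-comm y (+ 3)))))

instance
  pow3-nonZero : ∀ {n} → NonZero (pow3 n)
  pow3-nonZero {n} = ℕₚ.m^n≢0 3 n

3∣²⇒3∣ : ∀ U → + 3 ∣ U * U → + 3 ∣ U
3∣²⇒3∣ U 3∣U² with euclidsLemma ∣ U ∣ ∣ U ∣ (from-yes (prime? 3)) (subst (3 ℕᵈ.∣_) (ℤₚ.abs-* U U) (∣⇒∣ᵤ 3∣U²))
... | inj₁ 3∣U = ∣ᵤ⇒∣ 3∣U
... | inj₂ 3∣U = ∣ᵤ⇒∣ 3∣U

private
  pow3-double-suc : ∀ e → pow3 (suc e ℕ.+ suc e) ≡ + 3 * (+ 3 * pow3 (e ℕ.+ e))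
  pow3-double-suc e = trans (cong pow3 (cong suc (ℕₚ.+-suc e e)))
                            (trans (pow3-suc (suc (e ℕ.+ e))) (cong (+ 3 *_) (pow3-suc (e ℕ.+ e))))

  pow3-suc-* : ∀ t U → + 3 * (pow3 t * U) ≡ pow3 (suc t) * U
  pow3-suc-* t U = trans (sym (ℤₚ.*-assoc (+ 3) (pow3 t) U)) (cong (_* U) (sym (pow3-suc t)))

pow3-∣-square : ∀ e t U → pow3 (e ℕ.+ e) ∣ pow3 (suc t) * (U * U) → pow3 e ∣ pow3 t * U
pow3-∣-square zero t U _ = divides (pow3 t * U) (sym (ℤₚ.*-identityʳ _))
-- 3 ∣ U² forces U = 3V, which reduces the claim to 3^(2e) ∣ 3V².
pow3-∣-square (suc e) zero U h =
  subst₂ _∣_ (sym (pow3-suc e)) (trans (lemma₂ V) (cong (+ 1 *_) (sym U≡3V))) (*-monoʳ-∣ (+ 3) 3^e∣V)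
  where
  h′ : + 3 * (+ 3 * pow3 (e ℕ.+ e)) ∣ + 3 * (U * U)
  h′ = subst (_∣ + 3 * (U * U)) (pow3-double-suc e) h
  3∣U : + 3 ∣ U
  3∣U = 3∣²⇒3∣ U (*-cancelˡ-∣ (+ 3)
    (∣-trans (*-monoʳ-∣ (+ 3) (divides (pow3 (e ℕ.+ e)) (ℤₚ.*-comm (+ 3) (pow3 (e ℕ.+ e))))) h′))
  V = quotient 3∣U
  U≡3V : U ≡ V * + 3
  U≡3V = _∣_.equality 3∣U
  lemma₁ : ∀ V → + 3 * ((V * + 3) * (V * + 3)) ≡ + 3 * (+ 3 * (+ 3 * (V * V)))
  lemma₁ = solve-∀
  3^e∣V : pow3 e ∣ pow3 0 * V
  3^e∣V = pow3-∣-square e zero V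
    (*-cancelˡ-∣ (+ 3) (*-cancelˡ-∣ (+ 3) (subst (_ ∣_) (trans (cong (λ u → + 3 * (u * u)) U≡3V) (lemma₁ V)) h′)))
  lemma₂ : ∀ V → + 3 * (+ 1 * V) ≡ + 1 * (V * + 3)
  lemma₂ = solve-∀
pow3-∣-square (suc e) (suc t) U h =
  subst₂ _∣_ (sym (pow3-suc e)) (pow3-suc-* t U) (*-monoʳ-∣ (+ 3) (pow3-∣-square e t U 3^2e∣3^t₊₁U²))
  where
  h′ : + 3 * (+ 3 * pow3 (e ℕ.+ e)) ∣ + 3 * (+ 3 * (pow3 t * (U * U)))
  h′ = subst₂ _∣_ (pow3-double-suc e)
         (trans (cong (_* (U * U)) (trans (pow3-suc (suc t)) (cong (+ 3 *_) (pow3-suc t)))) (lemma (pow3 t) (U * U))) h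
    where
    lemma : ∀ a b → (+ 3 * (+ 3 * a)) * b ≡ + 3 * (+ 3 * (a * b))
    lemma = solve-∀
  3^2e∣3^t₊₁U² : pow3 (e ℕ.+ e) ∣ pow3 (suc t) * (U * U)
  3^2e∣3^t₊₁U² = ∣-trans (*-cancelˡ-∣ (+ 3) (*-cancelˡ-∣ (+ 3) h′))
                   (subst (pow3 t * (U * U) ∣_) (pow3-suc-* t (U * U)) (∣n⇒∣m*n (+ 3) (∣-refl {pow3 t * (U * U)})))

res-coherent : ∀ x {n m} → n ℕ.≤ m → res x m ≡ res x n [mod pow3 n ]
res-coherent x {n} {m} n≤m = subst (λ m → res x m ≡ res x n [mod pow3 n ]) (ℕₚ.m+[n∸m]≡n n≤m) (go (m ℕ.∸ n))
  where
  go : ∀ j → res x (n ℕ.+ j) ≡ res x n [mod pow3 n ]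
  go zero rewrite ℕₚ.+-identityʳ n = mod-refl
  go (suc j) rewrite ℕₚ.+-suc n j =
    mod-trans (mod-weaken (pow3-∣ (ℕₚ.m≤m+n n j)) (mod (coh x (n ℕ.+ j)))) (go j)

res-coherent₂ : ∀ x {b n m} → b ℕ.≤ n → b ℕ.≤ m → res x n ≡ res x m [mod pow3 b ]
res-coherent₂ x b≤n b≤m = mod-trans (res-coherent x b≤n) (mod-sym (res-coherent x b≤m))

-- For q = x / 3^d, q ≋ z mod3^ k says x ≡ z·3^d modulo 3^(d+k) in ℤ₃;
-- in particular q is a 3-adic integer.
infix 4 _≋_mod3^_
record _≋_mod3^_ (q : ℚ₃) (z : ℤ) (k : ℕ) : Set where
  constructor mk≋
  field
    digits : ∀ n → den q ℕ.+ k ℕ.≤ n →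
             res (num q) n ≡ z * pow3 (den q) [mod pow3 (den q ℕ.+ k) ]
open _≋_mod3^_ public

≋-fromTail : ∀ {q k z} M → den q ℕ.+ k ℕ.≤ M →
  (∀ n → M ℕ.≤ n → res (num q) n ≡ z * pow3 (den q) [mod pow3 (den q ℕ.+ k) ]) →
  q ≋ z mod3^ k
≋-fromTail {q} M le h = mk≋ λ n le′ →
  mod-trans (res-coherent₂ (num q) le′ (ℕₚ.≤-trans le (ℕₚ.m≤n+m M n))) (h (n ℕ.+ M) (ℕₚ.m≤n+m M n))

≋-fromDigit : ∀ {q k z} →
  res (num q) (den q ℕ.+ k) ≡ z * pow3 (den q) [mod pow3 (den q ℕ.+ k) ] → q ≋ z mod3^ k
≋-fromDigit {q} h = mk≋ λ n le → mod-trans (res-coherent (num q) le) h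

≋-digits-scaled : ∀ {q z k} e {c n} → q ≋ z mod3^ k → (den q ℕ.+ k) ℕ.+ e ≡ c → c ℕ.≤ n →
  res (num q) n * pow3 e ≡ (z * pow3 (den q)) * pow3 e [mod pow3 c ]
≋-digits-scaled {q} {k = k} e (mk≋ h) refl c≤n =
  mod-modulus (sym (pow3-+ (den q ℕ.+ k) e))
    (mod-scale (pow3 e) (h _ (ℕₚ.≤-trans (ℕₚ.m≤m+n _ e) c≤n)))

private
  shuffleˡ : ∀ d e k → (d ℕ.+ k) ℕ.+ e ≡ (d ℕ.+ e) ℕ.+ k
  shuffleˡ = ℕ-Solver.solve-∀
  shuffleʳ : ∀ d e k → (e ℕ.+ k) ℕ.+ d ≡ (d ℕ.+ e) ℕ.+ k
  shuffleʳ = ℕ-Solver.solve-∀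

≋-+ : ∀ q r {k z w} → q ≋ z mod3^ k → r ≋ w mod3^ k → q +ₚ r ≋ z + w mod3^ k
≋-+ q r {k} {z} {w} hq hr = mk≋ λ n le →
  mod-trans (mod-+ (≋-digits-scaled e hq (shuffleˡ d e k) le) (≋-digits-scaled d hr (shuffleʳ d e k) le))
    (mod-reflexive (trans (lemma z w (pow3 d) (pow3 e)) (cong ((z + w) *_) (sym (pow3-+ d e)))))
  where
  d = den q
  e = den r
  lemma : ∀ z w a b → (z * a) * b + (w * b) * a ≡ (z + w) * (a * b)
  lemma = solve-∀

≋-* : ∀ q r {k z w} → q ≋ z mod3^ k → r ≋ w mod3^ k → q *ₚ r ≋ z * w mod3^ k
≋-* q r {k} {z} {w} (mk≋ hq) (mk≋ hr) = mk≋ λ n le →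
  let Q = res (num q) n
      R = res (num r) n
      cq = hq n (ℕₚ.≤-trans (ℕₚ.m≤m+n _ e) (ℕₚ.≤-trans (ℕₚ.≤-reflexive (shuffleˡ d e k)) le))
      cr = hr n (ℕₚ.≤-trans (ℕₚ.m≤m+n _ d) (ℕₚ.≤-trans (ℕₚ.≤-reflexive (shuffleʳ d e k)) le))
      d∣Q : pow3 d ∣ Q
      d∣Q = mod-∣ (mod-weaken (pow3-∣ (ℕₚ.m≤m+n d k)) cq) (divides z refl)
  in mod (subst (_ ∣_) (lemma Q R z w (pow3 d) (pow3 e) (pow3 (d ℕ.+ e)) (pow3-+ d e))
       (∣m∣n⇒∣m+n
         (subst (_∣ _) (sym (pow3-split d (e ℕ.+ k) (assoc d e k))) (∣-* d∣Q (∣-diff cr)))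
         (subst (_∣ _) (sym (pow3-split (d ℕ.+ k) e (shuffleˡ d e k))) (∣-* (∣-diff cq) (divides w refl)))))
  where
  d = den q
  e = den r
  assoc : ∀ d e k → d ℕ.+ (e ℕ.+ k) ≡ (d ℕ.+ e) ℕ.+ k
  assoc d e k = sym (ℕₚ.+-assoc d e k)
  lemma : ∀ Q R z w a b c → c ≡ a * b →
          Q * (R - w * b) + (Q - z * a) * (w * b) ≡ Q * R - (z * w) * c
  lemma Q R z w a b c refl = ring Q R z w a b
    where
    ring : ∀ Q R z w a b → Q * (R - w * b) + (Q - z * a) * (w * b) ≡ Q * R - (z * w) * (a * b)
    ring = solve-∀

≋-neg : ∀ q {k z} → q ≋ z mod3^ k → -ₚ q ≋ - z mod3^ k
≋-neg q {z = z} (mk≋ h) = mk≋ λ n le →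
  mod-trans (mod-neg (h n le)) (mod-reflexive (ℤₚ.neg-distribˡ-* z (pow3 (den q))))

≋-neg⁻¹ : ∀ q {k w} → -ₚ q ≋ w mod3^ k → q ≋ - w mod3^ k
≋-neg⁻¹ q {w = w} (mk≋ h) = mk≋ λ n le →
  mod-trans (mod-reflexive (sym (ℤₚ.neg-involutive (res (num q) n))))
    (mod-trans (mod-neg (h n le)) (mod-reflexive (ℤₚ.neg-distribˡ-* w (pow3 (den q)))))

≋-fromℤ : ∀ z k → fromℤ z ≋ z mod3^ k
≋-fromℤ z k = mk≋ λ n le → mod-reflexive (sym (ℤₚ.*-identityʳ z))

≋-3* : ∀ y {k u} → y ≋ u mod3^ k → fromℤ (+ 3) *ₚ y ≋ + 3 * u mod3^ suc k
≋-3* y {k} {u} (mk≋ h) = mk≋ λ n le →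
  mod-modulus (sym (trans (cong pow3 (ℕₚ.+-suc d k)) (pow3-suc (d ℕ.+ k))))
    (mod-trans (mod-reflexive (ℤₚ.*-comm (+ 3) (res (num y) n)))
      (mod-trans (mod-modulus (ℤₚ.*-comm (pow3 (d ℕ.+ k)) (+ 3))
                   (mod-scale (+ 3) (h n (ℕₚ.≤-trans (ℕₚ.+-monoʳ-≤ d (ℕₚ.n≤1+n k)) le))))
        (mod-reflexive (lemma u (pow3 d)))))
  where
  d = den y
  lemma : ∀ u a → (u * a) * + 3 ≡ (+ 3 * u) * a
  lemma = solve-∀

private
  pow3-suc-scaled : ∀ d z → z * pow3 (suc d) ≡ (+ 3 * z) * pow3 d
  pow3-suc-scaled d z = trans (cong (z *_) (pow3-suc d)) (lemma z (pow3 d))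
    where
    lemma : ∀ z a → z * (+ 3 * a) ≡ (+ 3 * z) * a
    lemma = solve-∀

≋-div3 : ∀ w {k z} → w ≋ + 3 * z mod3^ suc k → div3 w ≋ z mod3^ k
≋-div3 w {k} {z} (mk≋ h) = mk≋ λ n le →
  mod-trans (subst (λ t → t ℕ.≤ n → res (num w) n ≡ (+ 3 * z) * pow3 (den w) [mod pow3 t ])
                   {den w ℕ.+ suc k} {suc (den w ℕ.+ k)} (ℕₚ.+-suc (den w) k) (h n) le)
    (mod-reflexive (sym (pow3-suc-scaled (den w) z)))

≋-div3⁻¹ : ∀ w {k z} → div3 w ≋ z mod3^ k → w ≋ + 3 * z mod3^ suc k
≋-div3⁻¹ w {k} {z} (mk≋ h) = mk≋ λ n le →
  subst (λ t → res (num w) n ≡ (+ 3 * z) * pow3 (den w) [mod pow3 t ]) (sym (ℕₚ.+-suc (den w) k))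
    (mod-trans (h n (subst (ℕ._≤ n) (ℕₚ.+-suc (den w) k) le))
      (mod-reflexive (pow3-suc-scaled (den w) z)))

≋-unique : ∀ {q k z w} → q ≋ z mod3^ k → q ≋ w mod3^ k → z ≡ w [mod pow3 k ]
≋-unique {q} {k} (mk≋ hz) (mk≋ hw) =
  mod-cancel (pow3 (den q)) {{pow3-nonZero {den q}}}
    (mod-modulus (pow3-split k (den q) (ℕₚ.+-comm k (den q)))
      (mod-trans (mod-sym (hz _ ℕₚ.≤-refl)) (hw _ ℕₚ.≤-refl)))

≋-resp : ∀ {q k z w} → q ≋ z mod3^ k → z ≡ w [mod pow3 k ] → q ≋ w mod3^ k
≋-resp {q} {k} (mk≋ h) z≡w = mk≋ λ n le →
  mod-trans (h n le)
    (mod-modulus (sym (pow3-split k (den q) (ℕₚ.+-comm k (den q)))) (mod-scale (pow3 (den q)) z≡w))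

≋-lower : ∀ {q k k′ z} → k ℕ.≤ k′ → q ≋ z mod3^ k′ → q ≋ z mod3^ k
≋-lower {q} k≤k′ (mk≋ h) =
  ≋-fromTail _ (ℕₚ.+-monoʳ-≤ (den q) k≤k′)
    (λ n le → mod-weaken (pow3-∣ (ℕₚ.+-monoʳ-≤ (den q) k≤k′)) (h n le))

≋-resp-≈ : ∀ q r {k z} → q ≈ r → q ≋ z mod3^ k → r ≋ z mod3^ k
≋-resp-≈ q r {k} {z} q≈r hq =
  ≋-fromTail ((e ℕ.+ k) ℕ.+ d) (ℕₚ.m≤m+n _ d) λ n le →
    mod-cancel (pow3 d) {{pow3-nonZero {d}}}
      (mod-modulus (pow3-split (e ℕ.+ k) d refl)
        (mod-trans (mod-sym (mod-weaken (pow3-∣ le) (mod (q≈r n))))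
          (mod-trans (≋-digits-scaled e hq (shuffle d e k) le)
            (mod-reflexive (lemma z (pow3 d) (pow3 e))))))
  where
  d = den q
  e = den r
  shuffle : ∀ d e k → (d ℕ.+ k) ℕ.+ e ≡ (e ℕ.+ k) ℕ.+ d
  shuffle = ℕ-Solver.solve-∀
  lemma : ∀ z a b → (z * a) * b ≡ (z * b) * a
  lemma = solve-∀

≋-cancelʳ : ∀ q r {k s t} → q +ₚ r ≋ s mod3^ k → r ≋ t mod3^ k → q ≋ s - t mod3^ k
≋-cancelʳ q r {k} {s} {t} (mk≋ h) hr =
  ≋-fromTail ((d ℕ.+ e) ℕ.+ k) (ℕₚ.+-monoˡ-≤ k (ℕₚ.m≤m+n d e)) λ n le →
    mod-cancel (pow3 e) {{pow3-nonZero {e}}}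
      (mod-modulus (pow3-split (d ℕ.+ k) e (shuffleˡ d e k))
        (mod-trans (mod-reflexive (sym (lemma₁ (res (num q) n) (res (num r) n) (pow3 d) (pow3 e))))
          (mod-trans (mod-+ (h n le) (mod-neg (≋-digits-scaled d hr (shuffleʳ d e k) le)))
            (mod-reflexive (trans (cong (λ x → s * x + - ((t * pow3 e) * pow3 d)) (pow3-+ d e))
                                  (lemma₂ s t (pow3 d) (pow3 e)))))))
  where
  d = den q
  e = den r
  lemma₁ : ∀ Q R a b → (Q * b + R * a) + - (R * a) ≡ Q * b
  lemma₁ = solve-∀
  lemma₂ : ∀ s t a b → s * (a * b) + - ((t * b) * a) ≡ ((s - t) * a) * b
  lemma₂ = solve-∀

≋-cancelˡ : ∀ q r {k s t} → q +ₚ r ≋ s mod3^ k → q ≋ t mod3^ k → r ≋ s - t mod3^ k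
≋-cancelˡ q r {k} {s} {t} (mk≋ h) hq =
  ≋-fromTail ((d ℕ.+ e) ℕ.+ k) (ℕₚ.+-monoˡ-≤ k (ℕₚ.m≤n+m e d)) λ n le →
    mod-cancel (pow3 d) {{pow3-nonZero {d}}}
      (mod-modulus (pow3-split (e ℕ.+ k) d (shuffleʳ d e k))
        (mod-trans (mod-reflexive (sym (lemma₁ (res (num q) n) (res (num r) n) (pow3 d) (pow3 e))))
          (mod-trans (mod-+ (h n le) (mod-neg (≋-digits-scaled e hq (shuffleˡ d e k) le)))
            (mod-reflexive (trans (cong (λ x → s * x + - ((t * pow3 d) * pow3 e)) (pow3-+ d e))
                                  (lemma₂ s t (pow3 d) (pow3 e)))))))
  where
  d = den q
  e = den r
  lemma₁ : ∀ Q R a b → (Q * b + R * a) + - (Q * b) ≡ R * a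
  lemma₁ = solve-∀
  lemma₂ : ∀ s t a b → s * (a * b) + - ((t * a) * b) ≡ ((s - t) * b) * a
  lemma₂ = solve-∀

IsIntegral : ℚ₃ → Set
IsIntegral q = q ≋ 0ℤ mod3^ 0

residue : ∀ {q} → IsIntegral q → ℕ → ℤ
residue {q} (mk≋ h) k = quotient (∣-diff (h (den q ℕ.+ k) (ℕₚ.+-monoʳ-≤ (den q) ℕ.z≤n)))

residue-≋ : ∀ {q} (iq : IsIntegral q) k → q ≋ residue iq k mod3^ k
residue-≋ {q} iq@(mk≋ h) k = ≋-fromDigit (mod-reflexive (begin
  res (num q) (d ℕ.+ k)                 ≡⟨ lemma (res (num q) (d ℕ.+ k)) (pow3 d) ⟩
  res (num q) (d ℕ.+ k) - 0ℤ * pow3 d   ≡⟨ _∣_.equality (∣-diff (h (d ℕ.+ k) (ℕₚ.+-monoʳ-≤ d ℕ.z≤n))) ⟩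
  residue iq k * pow3 (d ℕ.+ 0)         ≡⟨ cong (λ n → residue iq k * pow3 n) (ℕₚ.+-identityʳ d) ⟩
  residue iq k * pow3 d                 ∎))
  where
  open ≡-Reasoning
  d = den q
  lemma : ∀ x a → x ≡ x - 0ℤ * a
  lemma = solve-∀

≋⇒integral : ∀ {q k z} → q ≋ z mod3^ k → IsIntegral q
≋⇒integral hq = ≋-resp (≋-lower ℕ.z≤n hq) mod-1

≈-sym : ∀ q r → q ≈ r → r ≈ q
≈-sym q r q≈r n = subst (pow3 n ∣_) (lemma (res (num q) n * pow3 (den r)) (res (num r) n * pow3 (den q)))
                        (∣m⇒∣-m (q≈r n))
  where
  lemma : ∀ x y → - (x - y) ≡ y - x
  lemma = solve-∀

≋-0≢1 : ∀ {x} → x ≋ 0ℤ mod3^ 1 → x ≋ + 1 mod3^ 1 → ⊥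
≋-0≢1 x≡0 x≡1 = ℕᵈ.>⇒∤ (ℕ.s≤s (ℕ.s≤s (ℕ.z≤n {1}))) (∣⇒∣ᵤ (∣-diff (mod-sym (≋-unique x≡0 x≡1))))

fromCoherent : (s : ℕ → ℤ) → (∀ n → s (suc n) ≡ s n [mod pow3 n ]) → ℚ₃
fromCoherent s s-coherent = mkℤ₃ s (λ n → ∣-diff (s-coherent n)) /3^ 0

fromCoherent-≋ : ∀ s s-coherent k → fromCoherent s s-coherent ≋ s k mod3^ k
fromCoherent-≋ s _ k = ≋-fromDigit (mod-reflexive (sym (ℤₚ.*-identityʳ (s k))))

infix 4 _∼_mod3^_ _≃_

_∼_mod3^_ : ℚ₃ → ℚ₃ → ℕ → Set
x ∼ c mod3^ k = Σ ℤ λ z → x ≋ z mod3^ k × c ≋ z mod3^ k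

_≃_ : ℚ₃ → ℚ₃ → Set
x ≃ c = ∀ k → x ∼ c mod3^ k

∼-refl : ∀ {x} → IsIntegral x → ∀ k → x ∼ x mod3^ k
∼-refl ix k = residue ix k , residue-≋ ix k , residue-≋ ix k

∼-sym : ∀ {k x c} → x ∼ c mod3^ k → c ∼ x mod3^ k
∼-sym (z , hx , hc) = z , hc , hx

∼-trans : ∀ {k x y w} → x ∼ y mod3^ k → y ∼ w mod3^ k → x ∼ w mod3^ k
∼-trans (z , hx , hy) (z′ , hy′ , hw) = z′ , ≋-resp hx (≋-unique hy hy′) , hw

∼-lower : ∀ {k k′ x c} → k ℕ.≤ k′ → x ∼ c mod3^ k′ → x ∼ c mod3^ k
∼-lower le (z , hx , hc) = z , ≋-lower le hx , ≋-lower le hc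

∼⇒integralˡ : ∀ {k x c} → x ∼ c mod3^ k → IsIntegral x
∼⇒integralˡ (z , hx , hc) = ≋⇒integral hx

∼⇒integralʳ : ∀ {k x c} → x ∼ c mod3^ k → IsIntegral c
∼⇒integralʳ (z , hx , hc) = ≋⇒integral hc

∼-≋ : ∀ {k x c w} → x ∼ c mod3^ k → c ≋ w mod3^ k → x ≋ w mod3^ k
∼-≋ (z , hx , hc) c≋w = ≋-resp hx (≋-unique hc c≋w)

∼-shift : ∀ x x′ {k c} → x -ₚ x′ ≋ 0ℤ mod3^ k → x ∼ c mod3^ k → x′ ∼ c mod3^ k
∼-shift x x′ h (z , hx , hc) =
  z , ≋-resp (≋-neg⁻¹ x′ (≋-cancelˡ x (-ₚ x′) h hx)) (mod-reflexive (lemma z)) , hc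
  where
  lemma : ∀ z → - (0ℤ - z) ≡ z
  lemma = solve-∀

≃-fromSuc : ∀ {x c} → (∀ k → x ∼ c mod3^ suc k) → x ≃ c
≃-fromSuc h k = ∼-lower (ℕₚ.n≤1+n k) (h k)

≃-sym : ∀ {x c} → x ≃ c → c ≃ x
≃-sym x≃c k = ∼-sym (x≃c k)

≃-trans : ∀ {x y w} → x ≃ y → y ≃ w → x ≃ w
≃-trans x≃y y≃w k = ∼-trans (x≃y k) (y≃w k)

≈⇒≃ : ∀ x c → x ≈ c → IsIntegral c → x ≃ c
≈⇒≃ x c x≈c ic k = residue ic k , ≋-resp-≈ c x (≈-sym x c x≈c) (residue-≋ ic k) , residue-≋ ic k

≃⇒≈ : ∀ q r → q ≃ r → q ≈ r
≃⇒≈ q r q≃r n with q≃r n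
... | z , hq , hr = ∣-diff (mod-trans (scaled q r hq)
                      (mod-trans (mod-reflexive (lemma z (pow3 (den q)) (pow3 (den r)))) (mod-sym (scaled r q hr))))
  where
  scaled : ∀ q r {z} → q ≋ z mod3^ n →
           res (num q) n * pow3 (den r) ≡ (z * pow3 (den q)) * pow3 (den r) [mod pow3 n ]
  scaled q r (mk≋ h) =
    mod-weaken (divides (pow3 (den r)) (ℤₚ.*-comm (pow3 n) (pow3 (den r))))
      (mod-scale (pow3 (den r))
        (mod-trans (mod-sym (res-coherent (num q) (ℕₚ.m≤n+m n (den q))))
          (mod-weaken (pow3-∣ (ℕₚ.m≤n+m n (den q))) (h (den q ℕ.+ n) ℕₚ.≤-refl))))
  lemma : ∀ z a b → (z * a) * b ≡ (z * b) * a
  lemma = solve-∀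

-- Bounded q t  means  |q|₃ ≤ 3^t.
record Bounded (q : ℚ₃) (t : ℕ) : Set where
  constructor mkBounded
  field bound : ∀ n → den q ℕ.≤ n → pow3 (den q) ∣ pow3 t * res (num q) n
open Bounded public

bounded-fromTail : ∀ {q t} M → den q ℕ.≤ M →
  (∀ n → M ℕ.≤ n → pow3 (den q) ∣ pow3 t * res (num q) n) → Bounded q t
bounded-fromTail {q} {t} M le h = mkBounded λ n le′ →
  subst (pow3 (den q) ∣_) (lemma (pow3 t) (res (num q) (n ℕ.+ M)) (res (num q) n))
    (∣m∣n⇒∣m+n (h (n ℕ.+ M) (ℕₚ.m≤n+m M n))
      (∣n⇒∣m*n (pow3 t) (∣-diff (res-coherent₂ (num q) le′ (ℕₚ.≤-trans le (ℕₚ.m≤n+m M n))))))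
  where
  lemma : ∀ a x y → a * x + a * (y - x) ≡ a * y
  lemma = solve-∀

bounded-+ : ∀ q r {t} → Bounded q t → Bounded r t → Bounded (q +ₚ r) t
bounded-+ q r {t} (mkBounded hq) (mkBounded hr) = mkBounded λ n le →
  subst₂ _∣_ (sym (pow3-+ (den q) (den r)))
             (lemma (pow3 t) (res (num q) n) (res (num r) n) (pow3 (den q)) (pow3 (den r)))
    (∣m∣n⇒∣m+n (∣-* (hq n (ℕₚ.≤-trans (ℕₚ.m≤m+n _ _) le)) (∣-refl {pow3 (den r)}))
               (∣-* (∣-refl {pow3 (den q)}) (hr n (ℕₚ.≤-trans (ℕₚ.m≤n+m _ _) le))))
  where
  lemma : ∀ a Q R x y → (a * Q) * y + x * (a * R) ≡ a * (Q * y + R * x)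
  lemma = solve-∀

bounded-neg : ∀ q {t} → Bounded q t → Bounded (-ₚ q) t
bounded-neg q {t} (mkBounded h) = mkBounded λ n le →
  subst (_ ∣_) (ℤₚ.neg-distribʳ-* (pow3 t) (res (num q) n)) (∣m⇒∣-m (h n le))

bounded-cancel : ∀ q r {t} → Bounded (q +ₚ r) t → Bounded q t → Bounded r t
bounded-cancel q r {t} (mkBounded h) (mkBounded hq) = bounded-fromTail (den q ℕ.+ den r) (ℕₚ.m≤n+m _ _) λ n le →
  *-cancelʳ-∣ (pow3 (den q)) {{pow3-nonZero {den q}}}
    (subst₂ _∣_ (trans (pow3-+ (den q) (den r)) (ℤₚ.*-comm (pow3 (den q)) (pow3 (den r))))
                (lemma (pow3 t) (res (num q) n) (res (num r) n) (pow3 (den q)) (pow3 (den r)))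
      (∣m∣n⇒∣m-n (h n le)
        (subst (_∣ (pow3 t * res (num q) n) * pow3 (den r)) (sym (pow3-+ (den q) (den r)))
               (∣-* (hq n (ℕₚ.≤-trans (ℕₚ.m≤m+n _ _) le)) (∣-refl {pow3 (den r)})))))
  where
  lemma : ∀ a Q R x y → a * (Q * y + R * x) - (a * Q) * y ≡ (a * R) * x
  lemma = solve-∀

bounded-div3 : ∀ w {t} → Bounded (div3 w) (suc t) → Bounded w t
bounded-div3 w {t} (mkBounded h) = bounded-fromTail (suc (den w)) (ℕₚ.n≤1+n _) λ n le →
  *-cancelˡ-∣ (+ 3)
    (subst₂ _∣_ (pow3-suc (den w)) (trans (cong (_* res (num w) n) (pow3-suc t)) (ℤₚ.*-assoc (+ 3) (pow3 t) _))
      (h n le))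

bounded-mono : ∀ q {t t′} → t ℕ.≤ t′ → Bounded q t → Bounded q t′
bounded-mono q {t} {t′} le (mkBounded h) = mkBounded λ n le′ →
  subst (_ ∣_) (trans (sym (ℤₚ.*-assoc (pow3 (t′ ℕ.∸ t)) (pow3 t) _))
                      (cong (_* res (num q) n) (sym (pow3-split (t′ ℕ.∸ t) t (ℕₚ.m∸n+n≡m le)))))
    (∣n⇒∣m*n (pow3 (t′ ℕ.∸ t)) (h n le′))

bounded-square : ∀ y {t} → Bounded (y *ₚ y) (suc t) → Bounded y t
bounded-square y {t} (mkBounded h) = bounded-fromTail (den y ℕ.+ den y) (ℕₚ.m≤m+n _ _) λ n le →
  pow3-∣-square (den y) t (res (num y) n) (h n le)

integral⇒bounded : ∀ q → IsIntegral q → Bounded q 0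
integral⇒bounded q (mk≋ h) = mkBounded λ n le →
  subst₂ (λ d x → pow3 d ∣ x) (ℕₚ.+-identityʳ (den q)) (sym (ℤₚ.*-identityˡ _))
    (mod-∣ (h n (subst (ℕ._≤ n) (sym (ℕₚ.+-identityʳ _)) le)) (divides 0ℤ refl))

bounded⇒integral : ∀ q → Bounded q 0 → IsIntegral q
bounded⇒integral q (mkBounded h) = mk≋ λ n le →
  mod (subst₂ (λ d x → pow3 d ∣ x) (sym (ℕₚ.+-identityʳ (den q))) (lemma (res (num q) n) (pow3 (den q)))
         (h n (subst (ℕ._≤ n) (ℕₚ.+-identityʳ (den q)) le)))
  where
  lemma : ∀ x a → + 1 * x ≡ x - 0ℤ * a
  lemma = solve-∀

normLe⁻⇒≋0 : ∀ x k → normLe x -[1+ k ] → x ≋ 0ℤ mod3^ suc k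
normLe⁻⇒≋0 x k h = ≋-fromDigit (mod (subst (_ ∣_) (lemma _ (pow3 (den x))) h))
  where
  lemma : ∀ x a → x ≡ x - 0ℤ * a
  lemma = solve-∀

≋0⇒normLe⁻ : ∀ x k → x ≋ 0ℤ mod3^ suc k → normLe x -[1+ k ]
≋0⇒normLe⁻ x k (mk≋ h) = mod-∣ (h _ ℕₚ.≤-refl) (divides 0ℤ refl)

private
  normLe⁺-elim : ∀ q m j → normLe q (+ m) → (+ den q) - (+ m) ≡ + j → divBy3^ j (num q)
  normLe⁺-elim q m j h eq with (+ den q) - (+ m)
  normLe⁺-elim q m j h refl | .(+ j) = h

  normLe⁺-intro : ∀ q m → (∀ j → (+ den q) - (+ m) ≡ + j → divBy3^ j (num q)) → normLe q (+ m)
  normLe⁺-intro q m h with (+ den q) - (+ m)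
  ... | + j = h j refl
  ... | -[1+ _ ] = tt

  ∸-≡ : ∀ d m j → (+ d) - (+ m) ≡ + j → j ℕ.≤ d
  ∸-≡ d m j eq = subst (j ℕ.≤_) (sym (ℤₚ.+-injective (trans (lemma (+ d) (+ m)) (cong (_+ + m) eq))))
                   (ℕₚ.m≤m+n j m)
    where
    lemma : ∀ x y → x ≡ (x - y) + y
    lemma = solve-∀

  -‿≥ : ∀ d m → m ℕ.≤ d → (+ d) - (+ m) ≡ + (d ℕ.∸ m)
  -‿≥ d zero le = cong +_ (ℕₚ.+-identityʳ d)
  -‿≥ d (suc m) le = ℤₚ.⊖-≥ le

integral⇒normLe : ∀ q m → IsIntegral q → normLe q (+ m)
integral⇒normLe q m iq = normLe⁺-intro q m λ j eq →
  let j≤d = ∸-≡ (den q) m j eq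
  in mod-∣ (mod-sym (res-coherent (num q) j≤d))
       (∣-trans (pow3-∣ j≤d) (subst (_ ∣_) (ℤₚ.*-identityˡ _) (bound (integral⇒bounded q iq) (den q) ℕₚ.≤-refl)))

normLe⇒bounded : ∀ q m → normLe q m → Bounded q ∣ m ∣
normLe⇒bounded q -[1+ k ] h = bounded-mono q ℕ.z≤n (integral⇒bounded q (≋⇒integral (normLe⁻⇒≋0 q k h)))
normLe⇒bounded q (+ m) h with ℕₚ.≤-total m (den q)
... | inj₁ m≤d = mkBounded λ n d≤n →
  let 3^[d-m]∣ = normLe⁺-elim q m (den q ℕ.∸ m) h (-‿≥ (den q) m m≤d)
      d-m≤n = ℕₚ.≤-trans (ℕₚ.m∸n≤m (den q) m) d≤n
  in subst₂ _∣_ (sym (pow3-split (den q ℕ.∸ m) m (ℕₚ.m∸n+n≡m m≤d))) (ℤₚ.*-comm _ (pow3 m))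
       (*-monoˡ-∣ (pow3 m) (mod-∣ (res-coherent (num q) d-m≤n) 3^[d-m]∣))
... | inj₂ d≤m = mkBounded λ n _ → ∣m⇒∣m*n (res (num q) n) (pow3-∣ d≤m)

≋0⇒normLe : ∀ q m → q ≋ 0ℤ mod3^ ∣ m ∣ → normLe q m
≋0⇒normLe q (+ m) h = integral⇒normLe q m (≋⇒integral h)
≋0⇒normLe q -[1+ k ] h = ≋0⇒normLe⁻ q k h

∼⇒normLe : ∀ x c m → x ∼ c mod3^ ∣ m ∣ → normLe (x -ₚ c) m
∼⇒normLe x c m (z , hx , hc) =
  ≋0⇒normLe (x -ₚ c) m (≋-resp (≋-+ x (-ₚ c) hx (≋-neg c hc)) (mod-reflexive (ℤₚ.+-inverseʳ z)))

∼⇒distLe : ∀ x₁ x₂ c₁ c₂ m → x₁ ∼ c₁ mod3^ ∣ m ∣ → x₂ ∼ c₂ mod3^ ∣ m ∣ → distLe (x₁ , x₂) (c₁ , c₂) m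
∼⇒distLe x₁ x₂ c₁ c₂ m x₁∼c₁ x₂∼c₂ = ∼⇒normLe x₁ c₁ m x₁∼c₁ , ∼⇒normLe x₂ c₂ m x₂∼c₂

-- Kept separate from ∼⇒distLe so that φ a (x , y) is unfolded only at variables: unfolding it at
-- concrete 3-adic numbers makes conversion checking blow up.
∼⇒distLe-φ : ∀ a x y z₁ z₂ m → z₁ ∼ (a +ₚ (fromℤ (+ 3) *ₚ y)) -ₚ (x *ₚ x) mod3^ ∣ m ∣ → z₂ ∼ x mod3^ ∣ m ∣ →
  distLe (z₁ , z₂) (φ a (x , y)) m
∼⇒distLe-φ a x y z₁ z₂ m = ∼⇒distLe z₁ z₂ ((a +ₚ (fromℤ (+ 3) *ₚ y)) -ₚ (x *ₚ x)) x m

-- The recurrence y₂ = a + 3y₀ − y₁²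

-- z = a + 3x − y² digit by digit; the factor 3 lets x be known to one digit less.
Recurrence : ℚ₃ → ℚ₃ → ℚ₃ → ℚ₃ → Set
Recurrence a x y z = ∀ {k u v A} → x ≋ u mod3^ k → y ≋ v mod3^ suc k → a ≋ A mod3^ suc k →
                     z ≋ A + + 3 * u - v * v mod3^ suc k

recurrence-φ : ∀ a x y → Recurrence a x y ((a +ₚ (fromℤ (+ 3) *ₚ x)) -ₚ (y *ₚ y))
recurrence-φ a x y hx hy ha =
  ≋-+ (a +ₚ (fromℤ (+ 3) *ₚ x)) (-ₚ (y *ₚ y)) (≋-+ a (fromℤ (+ 3) *ₚ x) ha (≋-3* x hx)) (≋-neg (y *ₚ y) (≋-* y y hy hy))

recurrence-φ⁻¹ : ∀ a y z → Recurrence a (div3 ((z -ₚ a) +ₚ (y *ₚ y))) y z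
recurrence-φ⁻¹ a y z {u = u} {v} {A} hx hy ha =
  ≋-resp (≋-cancelʳ z (-ₚ a) (≋-cancelʳ (z -ₚ a) (y *ₚ y) (≋-div3⁻¹ ((z -ₚ a) +ₚ (y *ₚ y)) hx) (≋-* y y hy hy))
                           (≋-neg a ha))
    (mod-reflexive (lemma u v A))
  where
  lemma : ∀ u v A → ((+ 3 * u) - v * v) - (- A) ≡ A + + 3 * u - v * v
  lemma = solve-∀

module _ {a : ℚ₃} (ia : IsIntegral a) where

  recurrence-∼ : ∀ {x₀ x₁ x₂ c₀ c₁ c₂ k v v′} →
    Recurrence a x₀ x₁ x₂ → Recurrence a c₀ c₁ c₂ → x₀ ∼ c₀ mod3^ k →
    x₁ ≋ v mod3^ suc k → c₁ ≋ v′ mod3^ suc k → v * v ≡ v′ * v′ [mod pow3 (suc k) ] →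
    x₂ ∼ c₂ mod3^ suc k
  recurrence-∼ {k = k} {v} {v′} rx rc (u , hx₀ , hc₀) hx₁ hc₁ v²≡v′² =
    A + + 3 * u - v * v , rx hx₀ hx₁ hA ,
    ≋-resp (rc hc₀ hc₁ hA) (mod-+ (mod-refl {x = A + + 3 * u}) (mod-neg (mod-sym v²≡v′²)))
    where
    A = residue ia (suc k)
    hA = residue-≋ ia (suc k)

  recurrence-∼-suc : ∀ {x₀ x₁ x₂ c₀ c₁ c₂ k} →
    Recurrence a x₀ x₁ x₂ → Recurrence a c₀ c₁ c₂ →
    x₀ ∼ c₀ mod3^ k → x₁ ∼ c₁ mod3^ suc k → x₂ ∼ c₂ mod3^ suc k
  recurrence-∼-suc rx rc x₀∼c₀ (v , hx₁ , hc₁) = recurrence-∼ rx rc x₀∼c₀ hx₁ hc₁ mod-refl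

  recurrence-∼-same : ∀ {x₀ x₁ x₂ c₀ c₁ c₂ k} →
    Recurrence a x₀ x₁ x₂ → Recurrence a c₀ c₁ c₂ →
    x₀ ∼ c₀ mod3^ suc k → x₁ ∼ c₁ mod3^ suc k → x₂ ∼ c₂ mod3^ suc k
  recurrence-∼-same rx rc x₀∼c₀ = recurrence-∼-suc rx rc (∼-lower (ℕₚ.n≤1+n _) x₀∼c₀)

  recurrence-≃ : ∀ {x₀ x₁ x₂ c₀ c₁ c₂} → Recurrence a x₀ x₁ x₂ → Recurrence a c₀ c₁ c₂ →
    x₀ ≃ c₀ → x₁ ≃ c₁ → x₂ ≃ c₂
  recurrence-≃ rx rc x₀≃c₀ x₁≃c₁ zero = ∼-lower ℕ.z≤n (recurrence-∼-suc rx rc (x₀≃c₀ 0) (x₁≃c₁ 1))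
  recurrence-≃ rx rc x₀≃c₀ x₁≃c₁ (suc k) = recurrence-∼-suc rx rc (x₀≃c₀ k) (x₁≃c₁ (suc k))

  -- v² − v′² = (v − v′)(v + v′), and 3 ∣ v + v′ because v ≡ v′ ≡ 0 (mod 3).
  recurrence-∼-gain : ∀ {x₀ x₁ x₂ c₀ c₁ c₂ k} →
    Recurrence a x₀ x₁ x₂ → Recurrence a c₀ c₁ c₂ → c₁ ≋ 0ℤ mod3^ 1 →
    x₀ ∼ c₀ mod3^ suc k → x₁ ∼ c₁ mod3^ suc k → x₂ ∼ c₂ mod3^ suc (suc k)
  recurrence-∼-gain {k = k} rx rc c₁≡0 x₀∼c₀ x₁∼c₁@(w , hx₁ , hc₁) =
    recurrence-∼ rx rc x₀∼c₀ hv hv′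
      (mod-modulus (sym (pow3-split (suc k) 1 (ℕₚ.+-comm (suc k) 1))) (difference-of-squares v≡v′ v+v′≡0))
    where
    ix₁ = ∼⇒integralˡ x₁∼c₁
    ic₁ = ∼⇒integralʳ x₁∼c₁
    v = residue ix₁ (suc (suc k))
    v′ = residue ic₁ (suc (suc k))
    hv = residue-≋ ix₁ (suc (suc k))
    hv′ = residue-≋ ic₁ (suc (suc k))
    v≡v′ : v ≡ v′ [mod pow3 (suc k) ]
    v≡v′ = mod-trans (≋-unique (≋-lower (ℕₚ.n≤1+n _) hv) hx₁) (mod-sym (≋-unique (≋-lower (ℕₚ.n≤1+n _) hv′) hc₁))
    v′≡0 : v′ ≡ 0ℤ [mod pow3 1 ]
    v′≡0 = ≋-unique (≋-lower (ℕ.s≤s ℕ.z≤n) hv′) c₁≡0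
    v+v′≡0 : v + v′ ≡ 0ℤ [mod pow3 1 ]
    v+v′≡0 = mod-+ (mod-trans (mod-weaken (pow3-∣ {1} {suc k} (ℕ.s≤s ℕ.z≤n)) v≡v′) v′≡0) v′≡0

  recurrence-∼-twoSteps : ∀ {x₀ x₁ x₂ x₃ c₀ c₁ c₂ c₃ k} →
    Recurrence a x₀ x₁ x₂ → Recurrence a x₁ x₂ x₃ → Recurrence a c₀ c₁ c₂ → Recurrence a c₁ c₂ c₃ →
    c₁ ≋ 0ℤ mod3^ 1 → x₀ ∼ c₀ mod3^ suc k → x₁ ∼ c₁ mod3^ suc k →
    x₂ ∼ c₂ mod3^ suc (suc k) × x₃ ∼ c₃ mod3^ suc (suc k)
  recurrence-∼-twoSteps rx₁ rx₂ rc₁ rc₂ c₁≡0 x₀∼c₀ x₁∼c₁ =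
    x₂∼c₂ , recurrence-∼-suc rx₂ rc₂ x₁∼c₁ x₂∼c₂
    where
    x₂∼c₂ = recurrence-∼-gain rx₁ rc₁ c₁≡0 x₀∼c₀ x₁∼c₁

  recurrence⁻¹-∼ : ∀ {x₀ x₁ c₀ c₁ c₂ k} → Recurrence a c₂ c₁ c₀ → IsIntegral c₂ →
    x₀ ∼ c₀ mod3^ suc k → x₁ ∼ c₁ mod3^ suc k → div3 ((x₀ -ₚ a) +ₚ (x₁ *ₚ x₁)) ∼ c₂ mod3^ k
  recurrence⁻¹-∼ {x₀} {x₁} {k = k} rc ic₂ (U , hx₀ , hc₀) (V , hx₁ , hc₁) =
    z , ≋-div3 ((x₀ -ₚ a) +ₚ (x₁ *ₚ x₁))
          (≋-resp (≋-+ (x₀ -ₚ a) (x₁ *ₚ x₁) (≋-+ x₀ (-ₚ a) hx₀′ (≋-neg a hA)) (≋-* x₁ x₁ hx₁ hx₁))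
                         (mod-reflexive (lemma A z V))) ,
    hz
    where
    z = residue ic₂ k
    hz = residue-≋ ic₂ k
    A = residue ia (suc k)
    hA = residue-≋ ia (suc k)
    hx₀′ = ≋-resp hx₀ (≋-unique hc₀ (rc hz hc₁ hA))
    lemma : ∀ A z V → ((A + + 3 * z - V * V) + - A) + V * V ≡ + 3 * z
    lemma = solve-∀

  recurrence⁻¹-≃ : ∀ {x₀ x₁ c₀ c₁ c₂} → Recurrence a c₂ c₁ c₀ → IsIntegral c₂ →
    x₀ ≃ c₀ → x₁ ≃ c₁ → div3 ((x₀ -ₚ a) +ₚ (x₁ *ₚ x₁)) ≃ c₂
  recurrence⁻¹-≃ rc ic₂ x₀≃c₀ x₁≃c₁ k = recurrence⁻¹-∼ rc ic₂ (x₀≃c₀ (suc k)) (x₁≃c₁ (suc k))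

forwardOrbit : ℚ₃ → ℚ₃² → ℕ → ℚ₃
forwardOrbit a β zero = proj₂ β
forwardOrbit a β (suc zero) = proj₁ β
forwardOrbit a β (suc (suc i)) =
  (a +ₚ (fromℤ (+ 3) *ₚ forwardOrbit a β i)) -ₚ (forwardOrbit a β (suc i) *ₚ forwardOrbit a β (suc i))

backwardOrbit : ℚ₃ → ℚ₃² → ℕ → ℚ₃
backwardOrbit a β zero = proj₁ β
backwardOrbit a β (suc zero) = proj₂ β
backwardOrbit a β (suc (suc j)) =
  div3 ((backwardOrbit a β j -ₚ a) +ₚ (backwardOrbit a β (suc j) *ₚ backwardOrbit a β (suc j)))

iter-φ : ∀ a β i → iter (φ a) i β ≡ (forwardOrbit a β (suc i) , forwardOrbit a β i)
iter-φ a β zero = refl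
iter-φ a β (suc i) =
  cong (φ a) {x = iter (φ a) i β} {y = forwardOrbit a β (suc i) , forwardOrbit a β i} (iter-φ a β i)

iter-φ⁻¹ : ∀ a β j → iter (φ⁻¹ a) j β ≡ (backwardOrbit a β j , backwardOrbit a β (suc j))
iter-φ⁻¹ a β zero = refl
iter-φ⁻¹ a β (suc j) =
  cong (φ⁻¹ a) {x = iter (φ⁻¹ a) j β} {y = backwardOrbit a β j , backwardOrbit a β (suc j)} (iter-φ⁻¹ a β j)

forwardOrbit-recurrence : ∀ a β i →
  Recurrence a (forwardOrbit a β i) (forwardOrbit a β (suc i)) (forwardOrbit a β (suc (suc i)))
forwardOrbit-recurrence a β i = recurrence-φ a (forwardOrbit a β i) (forwardOrbit a β (suc i))

backwardOrbit-recurrence : ∀ a β j →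
  Recurrence a (backwardOrbit a β (suc (suc j))) (backwardOrbit a β (suc j)) (backwardOrbit a β j)
backwardOrbit-recurrence a β j = recurrence-φ⁻¹ a (backwardOrbit a β (suc j)) (backwardOrbit a β j)

module _ {a : ℚ₃} (ia : IsIntegral a) where

  -- x₁² = 3x₂ − x₀ + a, so |x₁|² ≤ 3^(t+1) and hence |x₁| ≤ 3^t.
  bounded-φ⁻¹ : ∀ x₀ x₁ {t} → Bounded x₀ (suc t) → Bounded (div3 ((x₀ -ₚ a) +ₚ (x₁ *ₚ x₁))) (suc t) →
    Bounded x₁ t
  bounded-φ⁻¹ x₀ x₁ {t} b₀ b₂ =
    bounded-square x₁
      (bounded-cancel (x₀ -ₚ a) (x₁ *ₚ x₁)
        (bounded-mono ((x₀ -ₚ a) +ₚ (x₁ *ₚ x₁)) (ℕₚ.n≤1+n t) (bounded-div3 ((x₀ -ₚ a) +ₚ (x₁ *ₚ x₁)) b₂))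
        (bounded-+ x₀ (-ₚ a) b₀ (bounded-neg a (bounded-mono a ℕ.z≤n (integral⇒bounded a ia)))))

  backwardOrbit-integral : ∀ β m → (∀ j → normLe (backwardOrbit a β j) m) →
    ∀ j → ∣ m ∣ ℕ.≤ j → IsIntegral (backwardOrbit a β j)
  backwardOrbit-integral β m bounds j m≤j =
    bounded⇒integral (backwardOrbit a β j)
      (subst (λ i → Bounded (backwardOrbit a β i) 0) (ℕₚ.m+[n∸m]≡n m≤j)
        (descent ∣ m ∣ 0 (λ i → normLe⇒bounded (backwardOrbit a β i) m (bounds i)) (j ℕ.∸ ∣ m ∣)))
    where
    descent : ∀ t s → (∀ i → Bounded (backwardOrbit a β (s ℕ.+ i)) t) →
              ∀ i → Bounded (backwardOrbit a β ((s ℕ.+ t) ℕ.+ i)) 0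
    descent zero s b = subst (λ s → ∀ i → Bounded (backwardOrbit a β (s ℕ.+ i)) 0) (sym (ℕₚ.+-identityʳ s)) b
    descent (suc t) s b = subst (λ s → ∀ i → Bounded (backwardOrbit a β (s ℕ.+ i)) 0) (sym (ℕₚ.+-suc s t))
      (descent t (suc s) λ i →
        bounded-φ⁻¹ (backwardOrbit a β (s ℕ.+ i)) (backwardOrbit a β (suc (s ℕ.+ i))) (b i)
          (subst (λ l → Bounded (backwardOrbit a β l) (suc t))
                 (trans (ℕₚ.+-suc s (suc i)) (cong suc (ℕₚ.+-suc s i))) (b (suc (suc i)))))

-- Square roots by Hensel lifting

-- As b ≡ 1 (mod 3), 2√b ≡ −1 (mod 3), so the Newton step r ↦ r + (b − r²)/(2r) may be replaced
-- by r ↦ r − (b − r²), which still gains one digit: (r − D)² − b = −D (2r + 1 − D) with 3ⁿ ∣ D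
-- and 3 ∣ 2r + 1 − D.
module SquareRoot (b : ℕ → ℤ) (b-coherent : ∀ n → b (suc n) ≡ b n [mod pow3 n ])
                  (b≡1 : ∀ n → b (suc n) ≡ + 1 [mod + 3 ]) where

  root : ℕ → ℤ
  root zero = + 1
  root (suc n) = root n - (b (suc n) - root n * root n)

  defect : ℕ → ℤ
  defect n = b (suc n) - root n * root n

  private
    root-step : ∀ n → root n * root n ≡ b n [mod pow3 n ] → root n ≡ + 1 [mod + 3 ] →
      defect n ≡ 0ℤ [mod pow3 n ] × defect n ≡ 0ℤ [mod + 3 ]
    root-step n r²≡b r≡1 =
      mod-trans (mod-+ (b-coherent n) (mod-neg r²≡b)) (mod-reflexive (ℤₚ.+-inverseʳ (b n))) ,
      mod-trans (mod-+ (b≡1 n) (mod-neg (mod-* r≡1 r≡1))) mod-refl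

    root-spec : ∀ n → root n * root n ≡ b n [mod pow3 n ] × root n ≡ + 1 [mod + 3 ]
    root-spec zero = mod-1 , mod-refl
    root-spec (suc n) with root-spec n
    ... | r²≡b , r≡1 with root-step n r²≡b r≡1
    ...   | D≡0 , D≡0-mod-3 =
      mod (subst₂ _∣_ (sym (pow3-split n 1 (ℕₚ.+-comm n 1))) (lemma (root n) (b (suc n)))
            (∣-* (∣m⇒∣-m (∣-diff D≡0)) (∣-diff 2r+1-D≡0))) ,
      mod-trans (mod-+ r≡1 (mod-neg D≡0-mod-3)) mod-refl
      where
      2r+1-D≡0 : (+ 2 * root n + + 1) - defect n ≡ 0ℤ [mod + 3 ]
      2r+1-D≡0 = mod-trans (mod-+ (mod-+ (mod-* (mod-refl {x = + 2}) r≡1) mod-refl) (mod-neg D≡0-mod-3))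
                           (mod (divides (+ 1) refl))
      lemma : ∀ r b → (- ((b - r * r) - 0ℤ)) * (((+ 2 * r + + 1) - (b - r * r)) - 0ℤ)
                        ≡ (r - (b - r * r)) * (r - (b - r * r)) - b
      lemma = solve-∀

  root-square : ∀ n → root n * root n ≡ b n [mod pow3 n ]
  root-square n = proj₁ (root-spec n)

  root≡1 : ∀ n → root n ≡ + 1 [mod + 3 ]
  root≡1 n = proj₂ (root-spec n)

  root-coherent : ∀ n → root (suc n) ≡ root n [mod pow3 n ]
  root-coherent n = mod-trans (mod-+ (mod-refl {x = root n}) (mod-neg (proj₁ (root-step n (root-square n) (root≡1 n)))))
                              (mod-reflexive (ℤₚ.+-identityʳ (root n)))

-- The 2-cycle

module TwoCycle (a : ℚ₃) (a≡1 : a ≋ + 1 mod3^ 1) where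

  a-integral : IsIntegral a
  a-integral = ≋⇒integral a≡1

  α : ℕ → ℤ
  α = residue a-integral

  private
    α-coherent : ∀ n → α (suc n) - + 3 ≡ α n - + 3 [mod pow3 n ]
    α-coherent n =
      mod-+ (≋-unique (≋-lower (ℕₚ.n≤1+n n) (residue-≋ a-integral (suc n))) (residue-≋ a-integral n))
            (mod-refl {x = - + 3})

    α≡1 : ∀ n → α (suc n) - + 3 ≡ + 1 [mod + 3 ]
    α≡1 n =
      mod-trans (mod-+ (≋-unique (≋-lower (ℕ.s≤s ℕ.z≤n) (residue-≋ a-integral (suc n))) a≡1) (mod-refl {x = - + 3}))
                (mod (divides -1ℤ refl))

  open SquareRoot (λ n → α n - + 3) α-coherent α≡1 public using (root; root-square; root≡1; root-coherent)

  -- Only the residues p-≋ and q-≋ are ever used; letting p and q unfold makes conversion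
  -- checking blow up.
  opaque
    p q : ℚ₃
    p = fromCoherent (λ n → -1ℤ + root n) (λ n → mod-+ (mod-refl {x = -1ℤ}) (root-coherent n))
    q = fromCoherent (λ n → -1ℤ - root n) (λ n → mod-+ (mod-refl {x = -1ℤ}) (mod-neg (root-coherent n)))

    p-≋ : ∀ k → p ≋ -1ℤ + root k mod3^ k
    p-≋ = fromCoherent-≋ _ _

    q-≋ : ∀ k → q ≋ -1ℤ - root k mod3^ k
    q-≋ = fromCoherent-≋ _ _

  p≡0 : p ≋ 0ℤ mod3^ 1
  p≡0 = ≋-resp (p-≋ 1) (mod-+ (mod-refl {x = -1ℤ}) (root≡1 1))

  q≡1 : q ≋ + 1 mod3^ 1
  q≡1 = ≋-resp (q-≋ 1) (mod-trans (mod-+ (mod-refl {x = -1ℤ}) (mod-neg (root≡1 1))) (mod (divides -1ℤ refl)))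

  p-integral : IsIntegral p
  p-integral = ≋⇒integral p≡0

  q-integral : IsIntegral q
  q-integral = ≋⇒integral q≡1

  -- If r² = a − 3 then a + 3(−1 + r) − (−1 − r)² = −1 + r.
  recurrence-cycle : ∀ x y (r : ℕ → ℤ) → (∀ n → r (suc n) ≡ r n [mod pow3 n ]) →
    (∀ n → r n * r n ≡ α n - + 3 [mod pow3 n ]) →
    (∀ k → x ≋ -1ℤ + r k mod3^ k) → (∀ k → y ≋ -1ℤ - r k mod3^ k) → Recurrence a x y x
  recurrence-cycle x y r r-coherent r-square x≋ y≋ {k} {u} {v} {A} x≋u y≋v a≋A =
    ≋-resp (x≋ (suc k)) (mod-sym (mod-trans (mod-+ (mod-+ A≡ (mod-3* {k} u≡)) (mod-neg (mod-* v≡ v≡)))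
                                            (mod-reflexive (lemma R))))
    where
    R = r (suc k)
    u≡ : u ≡ -1ℤ + R [mod pow3 k ]
    u≡ = mod-trans (≋-unique x≋u (x≋ k)) (mod-+ (mod-refl {x = -1ℤ}) (mod-sym (r-coherent k)))
    v≡ : v ≡ -1ℤ - R [mod pow3 (suc k) ]
    v≡ = ≋-unique y≋v (y≋ (suc k))
    A≡ : A ≡ R * R + + 3 [mod pow3 (suc k) ]
    A≡ = mod-trans (≋-unique a≋A (residue-≋ a-integral (suc k)))
           (mod-trans (mod-reflexive (lemma′ (α (suc k)))) (mod-+ (mod-sym (r-square (suc k))) mod-refl))
      where
      lemma′ : ∀ x → x ≡ (x - + 3) + + 3
      lemma′ = solve-∀
    lemma : ∀ R → (R * R + + 3) + + 3 * (-1ℤ + R) + - ((-1ℤ - R) * (-1ℤ - R)) ≡ -1ℤ + R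
    lemma = solve-∀

  recurrence-pqp : Recurrence a p q p
  recurrence-pqp = recurrence-cycle p q root root-coherent root-square p-≋ q-≋

  recurrence-qpq : Recurrence a q p q
  recurrence-qpq = recurrence-cycle q p (λ n → - root n) (λ n → mod-neg (root-coherent n))
    (λ n → mod-trans (mod-reflexive (lemma (root n))) (root-square n)) q-≋
    (λ k → ≋-resp (p-≋ k) (mod-reflexive (cong (_+_ -1ℤ) (sym (ℤₚ.neg-involutive (root k))))))
    where
    lemma : ∀ r → (- r) * (- r) ≡ r * r
    lemma = solve-∀

  φ₁≃q : (a +ₚ (fromℤ (+ 3) *ₚ q)) -ₚ (p *ₚ p) ≃ q
  φ₁≃q = recurrence-≃ a-integral (recurrence-φ a q p) recurrence-qpq (∼-refl q-integral) (∼-refl p-integral)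

  φ₁-integral : IsIntegral ((a +ₚ (fromℤ (+ 3) *ₚ q)) -ₚ (p *ₚ p))
  φ₁-integral = ∼⇒integralˡ (φ₁≃q 0)

  φ²-cycle : φ a (φ a (p , q)) ≈² (p , q)
  φ²-cycle =
    ≃⇒≈ ((a +ₚ (fromℤ (+ 3) *ₚ p)) -ₚ (((a +ₚ (fromℤ (+ 3) *ₚ q)) -ₚ (p *ₚ p)) *ₚ ((a +ₚ (fromℤ (+ 3) *ₚ q)) -ₚ (p *ₚ p))))
        p (recurrence-≃ a-integral (recurrence-φ a p ((a +ₚ (fromℤ (+ 3) *ₚ q)) -ₚ (p *ₚ p))) recurrence-pqp
                         (∼-refl p-integral) φ₁≃q) ,
    ≃⇒≈ ((a +ₚ (fromℤ (+ 3) *ₚ q)) -ₚ (p *ₚ p)) q φ₁≃q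

  φ-not-fixed : ¬ (φ a (p , q) ≈² (p , q))
  φ-not-fixed (_ , p≈q) = ≋-0≢1 (≋-resp-≈ p q p≈q p≡0) q≡1

  ∼p-∼q-disjoint : ∀ {k k′ y} → y ∼ p mod3^ suc k → y ∼ q mod3^ suc k′ → ⊥
  ∼p-∼q-disjoint y∼p y∼q = ≋-0≢1 (∼-≋ (∼-lower (ℕ.s≤s ℕ.z≤n) y∼p) p≡0) (∼-≋ (∼-lower (ℕ.s≤s ℕ.z≤n) y∼q) q≡1)

  OnCycle : ℚ₃ → ℚ₃ → Set
  OnCycle y₀ y₁ = (y₀ ≃ q × y₁ ≃ p) ⊎ (y₀ ≃ p × y₁ ≃ q)

  onCycle-step : ∀ {y₀ y₁ y₂} → Recurrence a y₀ y₁ y₂ → OnCycle y₀ y₁ → OnCycle y₁ y₂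
  onCycle-step r (inj₁ (y₀≃q , y₁≃p)) = inj₂ (y₁≃p , recurrence-≃ a-integral r recurrence-qpq y₀≃q y₁≃p)
  onCycle-step r (inj₂ (y₀≃p , y₁≃q)) = inj₁ (y₁≃q , recurrence-≃ a-integral r recurrence-pqp y₀≃p y₁≃q)

  onCycle-φ⁻¹ : ∀ {y₁ y₂} → OnCycle y₁ y₂ → OnCycle (div3 ((y₂ -ₚ a) +ₚ (y₁ *ₚ y₁))) y₁
  onCycle-φ⁻¹ (inj₁ (y₁≃q , y₂≃p)) = inj₂ (recurrence⁻¹-≃ a-integral recurrence-pqp p-integral y₂≃p y₁≃q , y₁≃q)
  onCycle-φ⁻¹ (inj₂ (y₁≃p , y₂≃q)) = inj₁ (recurrence⁻¹-≃ a-integral recurrence-qpq q-integral y₂≃q y₁≃p , y₁≃p)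

  onCycle-integral : ∀ {y₀ y₁} → OnCycle y₀ y₁ → IsIntegral y₀ × IsIntegral y₁
  onCycle-integral (inj₁ (y₀≃q , y₁≃p)) = ∼⇒integralˡ (y₀≃q 0) , ∼⇒integralˡ (y₁≃p 0)
  onCycle-integral (inj₂ (y₀≃p , y₁≃q)) = ∼⇒integralˡ (y₀≃p 0) , ∼⇒integralˡ (y₁≃q 0)

  inCycle⇒onCycle : ∀ β → InCycle a (p , q) β → OnCycle (proj₂ β) (proj₁ β)
  inCycle⇒onCycle (β₁ , β₂) (inj₁ (β₁≈p , β₂≈q)) = inj₁ (≈⇒≃ β₂ q β₂≈q q-integral , ≈⇒≃ β₁ p β₁≈p p-integral)
  inCycle⇒onCycle (β₁ , β₂) (inj₂ (β₁≈φ₁ , β₂≈p)) =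
    inj₂ (≈⇒≃ β₂ p β₂≈p p-integral ,
          ≃-trans (≈⇒≃ β₁ ((a +ₚ (fromℤ (+ 3) *ₚ q)) -ₚ (p *ₚ p)) β₁≈φ₁ φ₁-integral) φ₁≃q)

  forwardOrbit-onCycle : ∀ β → InCycle a (p , q) β → ∀ i → OnCycle (forwardOrbit a β i) (forwardOrbit a β (suc i))
  forwardOrbit-onCycle β β∈C zero = inCycle⇒onCycle β β∈C
  forwardOrbit-onCycle β β∈C (suc i) = onCycle-step (forwardOrbit-recurrence a β i) (forwardOrbit-onCycle β β∈C i)

  backwardOrbit-onCycle : ∀ β → InCycle a (p , q) β → ∀ j → OnCycle (backwardOrbit a β (suc j)) (backwardOrbit a β j)
  backwardOrbit-onCycle β β∈C zero = inCycle⇒onCycle β β∈C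
  backwardOrbit-onCycle β β∈C (suc j) =
    onCycle-φ⁻¹ {backwardOrbit a β (suc j)} {backwardOrbit a β j} (backwardOrbit-onCycle β β∈C j)

  inCycle⇒J : ∀ β → InCycle a (p , q) β → J a β
  inCycle⇒J β β∈C = + 0 , λ where
      (+ n) → subst (λ w → norm²Le w (+ 0)) (sym (iter-φ a β n))
                (normLe₀ (proj₂ (forward n)) , normLe₀ (proj₁ (forward n)))
      -[1+ n ] → subst (λ w → norm²Le w (+ 0)) (sym (iter-φ⁻¹ a β (suc n)))
                   (normLe₀ (proj₁ (backward n)) , normLe₀ (proj₁ (backward (suc n))))
    where
    normLe₀ : ∀ {x} → IsIntegral x → normLe x (+ 0)
    normLe₀ {x} = integral⇒normLe x 0
    forward : ∀ i → IsIntegral (forwardOrbit a β i) × IsIntegral (forwardOrbit a β (suc i))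
    forward i = onCycle-integral (forwardOrbit-onCycle β β∈C i)
    backward : ∀ j → IsIntegral (backwardOrbit a β (suc j)) × IsIntegral (backwardOrbit a β j)
    backward j = onCycle-integral (backwardOrbit-onCycle β β∈C j)

  NearCycle : ℕ → ℚ₃ → ℚ₃ → Set
  NearCycle k y₀ y₁ = (y₀ ∼ q mod3^ k × y₁ ∼ p mod3^ k) ⊎ (y₀ ∼ p mod3^ k × y₁ ∼ q mod3^ k)

  onCycle⇒nearCycle : ∀ {k y₀ y₁} → OnCycle y₀ y₁ → NearCycle k y₀ y₁
  onCycle⇒nearCycle {k} (inj₁ (y₀≃q , y₁≃p)) = inj₁ (y₀≃q k , y₁≃p k)
  onCycle⇒nearCycle {k} (inj₂ (y₀≃p , y₁≃q)) = inj₂ (y₀≃p k , y₁≃q k)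

  nearCycle-step : ∀ {k y₀ y₁ y₂} → Recurrence a y₀ y₁ y₂ → NearCycle (suc k) y₀ y₁ → NearCycle (suc k) y₁ y₂
  nearCycle-step r (inj₁ (y₀∼q , y₁∼p)) = inj₂ (y₁∼p , recurrence-∼-same a-integral r recurrence-qpq y₀∼q y₁∼p)
  nearCycle-step r (inj₂ (y₀∼p , y₁∼q)) = inj₁ (y₁∼q , recurrence-∼-same a-integral r recurrence-pqp y₀∼p y₁∼q)

  -- From the phase (q , p) two steps pass through p ≡ 0 (mod 3) and gain a digit; from the
  -- phase (p , q) one more step is needed to reach (q , p).
  nearCycle-gain : ∀ {k y₀ y₁ y₂ y₃ y₄} →
    Recurrence a y₀ y₁ y₂ → Recurrence a y₁ y₂ y₃ → Recurrence a y₂ y₃ y₄ →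
    NearCycle (suc k) y₀ y₁ → NearCycle (suc (suc k)) y₃ y₄
  nearCycle-gain r₀ r₁ r₂ (inj₁ (y₀∼q , y₁∼p)) =
    inj₂ (proj₂ y₂y₃ , recurrence-∼-same a-integral r₂ recurrence-qpq (proj₁ y₂y₃) (proj₂ y₂y₃))
    where
    y₂y₃ = recurrence-∼-twoSteps a-integral r₀ r₁ recurrence-qpq recurrence-pqp p≡0 y₀∼q y₁∼p
  nearCycle-gain r₀ r₁ r₂ (inj₂ (y₀∼p , y₁∼q)) =
    inj₁ (recurrence-∼-twoSteps a-integral r₁ r₂ recurrence-qpq recurrence-pqp p≡0 y₁∼q
            (recurrence-∼-same a-integral r₀ recurrence-pqp y₀∼p y₁∼q))

  nearCycle-shift : ∀ y₀ y₁ y₀′ y₁′ {k} → y₀ -ₚ y₀′ ≋ 0ℤ mod3^ k → y₁ -ₚ y₁′ ≋ 0ℤ mod3^ k →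
    NearCycle k y₀ y₁ → NearCycle k y₀′ y₁′
  nearCycle-shift y₀ y₁ y₀′ y₁′ d₀ d₁ (inj₁ (y₀∼q , y₁∼p)) = inj₁ (∼-shift y₀ y₀′ d₀ y₀∼q , ∼-shift y₁ y₁′ d₁ y₁∼p)
  nearCycle-shift y₀ y₁ y₀′ y₁′ d₀ d₁ (inj₂ (y₀∼p , y₁∼q)) = inj₂ (∼-shift y₀ y₀′ d₀ y₀∼p , ∼-shift y₁ y₁′ d₁ y₁∼q)

  nearCycle⇒inCycle : ∀ β → (∀ h → NearCycle (suc h) (proj₂ β) (proj₁ β)) → InCycle a (p , q) β
  nearCycle⇒inCycle (β₁ , β₂) near with near 0
  ... | inj₁ (β₂∼q , _) =
    inj₁ (≃⇒≈ β₁ p (≃-fromSuc (λ h → proj₂ (phase h))) , ≃⇒≈ β₂ q (≃-fromSuc (λ h → proj₁ (phase h))))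
    where
    phase : ∀ h → β₂ ∼ q mod3^ suc h × β₁ ∼ p mod3^ suc h
    phase h with near h
    ... | inj₁ near-h = near-h
    ... | inj₂ (β₂∼p , _) = ⊥-elim (∼p-∼q-disjoint β₂∼p β₂∼q)
  ... | inj₂ (β₂∼p , _) =
    inj₂ (≃⇒≈ β₁ ((a +ₚ (fromℤ (+ 3) *ₚ q)) -ₚ (p *ₚ p)) (≃-trans (≃-fromSuc (λ h → proj₂ (phase h))) (≃-sym φ₁≃q)) ,
          ≃⇒≈ β₂ p (≃-fromSuc (λ h → proj₁ (phase h))))
    where
    phase : ∀ h → β₂ ∼ p mod3^ suc h × β₁ ∼ q mod3^ suc h
    phase h with near h
    ... | inj₁ (β₂∼q , _) = ⊥-elim (∼p-∼q-disjoint β₂∼p β₂∼q)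
    ... | inj₂ near-h = near-h

  module BoundedOrbit (β : ℚ₃²) (m : ℤ) (β-bounded : ∀ n → norm²Le (φ^ a n β) m) where

    backwardOrbit-normLe : ∀ j → normLe (backwardOrbit a β j) m
    backwardOrbit-normLe zero = proj₁ (β-bounded (+ 0))
    backwardOrbit-normLe (suc j) =
      subst (λ w → normLe (proj₁ w) m) (iter-φ⁻¹ a β (suc j)) (proj₁ (β-bounded -[1+ j ]))

    integral-from : ∀ j → ∣ m ∣ ℕ.≤ j → IsIntegral (backwardOrbit a β j)
    integral-from = backwardOrbit-integral a-integral β m backwardOrbit-normLe

    private
      ≤-+2 : ∀ {j} → ∣ m ∣ ℕ.≤ j → ∣ m ∣ ℕ.≤ suc (suc j)
      ≤-+2 m≤j = ℕₚ.≤-trans m≤j (ℕₚ.m≤n+m _ 2)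

    backward-mod-3 : ∀ j → ∣ m ∣ ℕ.≤ j → ∀ {w} → backwardOrbit a β (suc j) ≋ w mod3^ 1 →
      backwardOrbit a β j ≋ + 1 - w * w mod3^ 1
    backward-mod-3 j m≤j x≋w = backwardOrbit-recurrence a β j (integral-from (suc (suc j)) (≤-+2 m≤j)) x≋w a≡1

    zero-or-one : ∀ j → ∣ m ∣ ℕ.≤ j → backwardOrbit a β j ≋ 0ℤ mod3^ 1 ⊎ backwardOrbit a β j ≋ + 1 mod3^ 1
    zero-or-one j m≤j =
      [ (λ w²≡0 → inj₂ (≋-resp x≋1-w² (mod-+ (mod-refl {x = + 1}) (mod-neg w²≡0))))
      , (λ w²≡1 → inj₁ (≋-resp x≋1-w² (mod-+ (mod-refl {x = + 1}) (mod-neg w²≡1)))) ]′ (square-mod-3 w)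
      where
      ix = integral-from (suc j) (ℕₚ.≤-trans m≤j (ℕₚ.n≤1+n j))
      w = residue ix 1
      x≋1-w² : backwardOrbit a β j ≋ + 1 - w * w mod3^ 1
      x≋1-w² = backward-mod-3 j m≤j (residue-≋ ix 1)

    nearCycle-mod-3 : ∀ j → ∣ m ∣ ℕ.≤ j → NearCycle 1 (backwardOrbit a β (suc j)) (backwardOrbit a β j)
    nearCycle-mod-3 j m≤j =
      [ (λ x≡0 → inj₂ ((0ℤ , x≡0 , p≡0) , (+ 1 , backward-mod-3 j m≤j x≡0 , q≡1)))
      , (λ x≡1 → inj₁ ((+ 1 , x≡1 , q≡1) , (0ℤ , backward-mod-3 j m≤j x≡1 , p≡0))) ]′
      (zero-or-one (suc j) (ℕₚ.≤-trans m≤j (ℕₚ.n≤1+n j)))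

    nearCycle-from : ∀ h j → ∣ m ∣ ℕ.≤ j → NearCycle (suc h) (backwardOrbit a β (suc j)) (backwardOrbit a β j)
    nearCycle-from zero = nearCycle-mod-3
    nearCycle-from (suc h) j m≤j =
      nearCycle-gain (backwardOrbit-recurrence a β (suc (suc j))) (backwardOrbit-recurrence a β (suc j))
                     (backwardOrbit-recurrence a β j)
                     (nearCycle-from h (suc (suc (suc j))) (ℕₚ.≤-trans m≤j (ℕₚ.m≤n+m _ 3)))

    nearCycle-all : ∀ h j → NearCycle (suc h) (backwardOrbit a β (suc j)) (backwardOrbit a β j)
    nearCycle-all h j = go ∣ m ∣ j (ℕₚ.m≤m+n ∣ m ∣ j)
      where
      go : ∀ d j → ∣ m ∣ ℕ.≤ d ℕ.+ j → NearCycle (suc h) (backwardOrbit a β (suc j)) (backwardOrbit a β j)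
      go zero j m≤j = nearCycle-from h j m≤j
      go (suc d) j m≤d+j =
        nearCycle-step (backwardOrbit-recurrence a β j) (go d (suc j) (subst (∣ m ∣ ℕ.≤_) (sym (ℕₚ.+-suc d j)) m≤d+j))

  J⇒inCycle : ∀ β → J a β → InCycle a (p , q) β
  J⇒inCycle β (m , β-bounded) = nearCycle⇒inCycle β (λ h → BoundedOrbit.nearCycle-all β m β-bounded h 0)

  U : ℚ₃² → Set
  U β = NearCycle 1 (proj₂ β) (proj₁ β)

  inCycle⇒U : ∀ β → InCycle a (p , q) β → U β
  inCycle⇒U β β∈C = onCycle⇒nearCycle (inCycle⇒onCycle β β∈C)

  U-open : IsOpen U
  U-open (β₁ , β₂) β∈U = -[1+ 0 ] , λ where
    (γ₁ , γ₂) (d₁ , d₂) → nearCycle-shift β₂ β₁ γ₂ γ₁ (normLe⁻⇒≋0 (β₂ -ₚ γ₂) 0 d₂) (normLe⁻⇒≋0 (β₁ -ₚ γ₁) 0 d₁) β∈U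

  U-proper : ∃ λ β → U β × ¬ InCycle a (p , q) β
  U-proper = (p +ₚ fromℤ (+ 3) , q) , inj₁ (∼-refl q-integral 1 , (0ℤ , p+3≡0 , p≡0)) , ∉cycle
    where
    p+3≡0 : p +ₚ fromℤ (+ 3) ≋ 0ℤ mod3^ 1
    p+3≡0 = ≋-resp (≋-+ p (fromℤ (+ 3)) p≡0 (≋-fromℤ (+ 3) 1)) (mod (divides (+ 1) refl))
    ∉cycle : ¬ InCycle a (p , q) (p +ₚ fromℤ (+ 3) , q)
    ∉cycle (inj₁ (p+3≈p , _)) =
      +3≢-mod-9 z (≋-unique (≋-resp-≈ (p +ₚ fromℤ (+ 3)) p p+3≈p (≋-+ p (fromℤ (+ 3)) p≋z (≋-fromℤ (+ 3) 2))) p≋z)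
      where
      z = residue p-integral 2
      p≋z = residue-≋ p-integral 2
    ∉cycle (inj₂ (_ , q≈p)) = ≋-0≢1 p≡0 (≋-resp-≈ q p q≈p q≡1)

  forwardOrbit-near : ∀ β → U β → ∀ h d →
    NearCycle (suc h) (forwardOrbit a β (h ℕ.* 3 ℕ.+ d)) (forwardOrbit a β (suc (h ℕ.* 3 ℕ.+ d)))
  forwardOrbit-near β β∈U zero = go
    where
    go : ∀ i → NearCycle 1 (forwardOrbit a β i) (forwardOrbit a β (suc i))
    go zero = β∈U
    go (suc i) = nearCycle-step (forwardOrbit-recurrence a β i) (go i)
  forwardOrbit-near β β∈U (suc h) d =
    nearCycle-gain (forwardOrbit-recurrence a β i) (forwardOrbit-recurrence a β (suc i))
                   (forwardOrbit-recurrence a β (suc (suc i))) (forwardOrbit-near β β∈U h d)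
    where
    i = h ℕ.* 3 ℕ.+ d

  nearCycle⇒dist : ∀ y₀ y₁ m → NearCycle (suc ∣ m ∣) y₀ y₁ →
    distLe (y₁ , y₀) (p , q) m ⊎ distLe (y₁ , y₀) (φ a (p , q)) m
  nearCycle⇒dist y₀ y₁ m (inj₁ (y₀∼q , y₁∼p)) =
    inj₁ (∼⇒distLe y₁ y₀ p q m (∼-lower (ℕₚ.n≤1+n _) y₁∼p) (∼-lower (ℕₚ.n≤1+n _) y₀∼q))
  nearCycle⇒dist y₀ y₁ m (inj₂ (y₀∼p , y₁∼q)) =
    inj₂ (∼⇒distLe-φ a p q y₁ y₀ m
            (∼-lower (ℕₚ.n≤1+n _) (∼-trans y₁∼q (∼-sym (φ₁≃q _)))) (∼-lower (ℕₚ.n≤1+n _) y₀∼p))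

  U-attracts : ∀ β → U β → ∀ m → ∃ λ N → ∀ n → N ℕ.≤ n →
    distLe (iter (φ a) n β) (p , q) m ⊎ distLe (iter (φ a) n β) (φ a (p , q)) m
  -- The endpoints of both transports are given explicitly; inferring them would unfold distLe.
  U-attracts β β∈U m = ∣ m ∣ ℕ.* 3 , λ n N≤n →
    subst (λ w → distLe w (p , q) m ⊎ distLe w (φ a (p , q)) m)
          {x = forwardOrbit a β (suc n) , forwardOrbit a β n} {y = iter (φ a) n β} (sym (iter-φ a β n))
      (nearCycle⇒dist (forwardOrbit a β n) (forwardOrbit a β (suc n)) m
        (subst (λ i → NearCycle (suc ∣ m ∣) (forwardOrbit a β i) (forwardOrbit a β (suc i)))
               {x = ∣ m ∣ ℕ.* 3 ℕ.+ (n ℕ.∸ ∣ m ∣ ℕ.* 3)} {y = n} (ℕₚ.m+[n∸m]≡n N≤n)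
          (forwardOrbit-near β β∈U ∣ m ∣ (n ℕ.∸ ∣ m ∣ ℕ.* 3))))

theorem4p10 : (a : ℚ₃) → normLe (a -ₚ fromℤ (+ 1)) (-[1+ 0 ]) → JIsAttractingTwoCycle a
theorem4p10 a hyp =
  (p , q) , (φ²-cycle , φ-not-fixed , U , U-open , inCycle⇒U , U-proper , U-attracts) , J⇒inCycle , inCycle⇒J
  where
  a≡1 : a ≋ + 1 mod3^ 1
  a≡1 = ≋-cancelʳ a (-ₚ fromℤ (+ 1)) (normLe⁻⇒≋0 (a -ₚ fromℤ (+ 1)) 0 hyp) (≋-neg (fromℤ (+ 1)) (≋-fromℤ (+ 1) 1))
  open TwoCycle a a≡1
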